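{- Let $A=(a_{i,j})_{1\le i\le m,\,1\le j\le n}$ be an $m\times n$ matrix over a commutative ring with unity, with $m\le n$, and let $1\le k\le m-1$. Then $$R(x;z;A)=\sum_{\substack{S\subseteq N_m\setminus N_{m-k}\\ S\neq\emptyset}}\ \sum_{\varphi\in \mathrm{Inj}(S,N_n)} z^{|\varphi|}\Big(\prod_{i\in S}a_{i,\varphi(i)}\Big)\,R\big(x;z;A[N_{m-k}\,|\,\bar\varphi(N_n)]\big)\,x^{|S|}\;+\;R\big(x;z;A[N_{m-k}\,|\,N_n]\big).$$
   Context: $N_n=\{1,\dots,n\}$. For $S\subseteq N_n$, $\mathrm{Inj}(S,N_n)$ is the set of injective maps $S\to N_n$. For $\varphi\in\mathrm{Inj}(S,N_n)$, $|\varphi|$ denotes the number of cycles of $\varphi$, i.e. the number of nonempty sets $C\subseteq S$ of the form $C=\{j,\varphi(j),\dots,\varphi^{p-1}(j)\}$ with $\varphi^p(j)=j$. For an $m\times n$ matrix $A=(a_{i,j})$ with $m\le n$: $r_l(z;A)=\sum_{S\subseteq N_m,|S|=l}\sum_{\varphi\in\mathrm{Inj}(S,N_n)}z^{|\varphi|}\prod_{i\in S}a_{i,\varphi(i)}$ (so $r_0(z;A)=1$), and the cyclic rook polynomial is $R(x;z;A)=\sum_{l=0}^m r_l(z;A)x^l$ (equal to $1$ for a matrix with no rows). For a set of row indices $T$ (taken in increasing order) and a sequence of column indices $(c_1,\dots,c_q)$, $A[T\,|\,c_1,\dots,c_q]$ is the matrix whose rows are the rows of $A$ indexed by $T$ in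 increasing order and whose $s$-th column is column $c_s$ of $A$ (restricted to those rows); it is then re-indexed by $1,2,\dots$ in rows and columns, and $R(x;z;\cdot)$ is computed with respect to this new indexing. $A[T|N_n]$ means columns $1,\dots,n$ in order. For $S\subseteq N_n$ and $\varphi\in\mathrm{Inj}(S,N_n)$, define the bijection $\varphi^*:\varphi(S)\setminus S\to S\setminus\varphi(S)$: for $j\in\varphi(S)\setminus S$, put $j_0=j$, $j_l=\varphi^{ -1}(j_{l-1})$ as long as $j_{l-1}\in\varphi(S)$, and $\varphi^*(j)=j_m$ where $j_m$ is the first term lying in $S\setminus\varphi(S)$. For a sequence $(x_1,\dots,x_n)$, $\bar\varphi(x_1,\dots,x_n)$ is the sequence $(y_j)_{j\in N_n\setminus S}$ (in increasing order of $j$) with $y_j=x_j$ if $j\notin\varphi(S)$ and $y_j=x_{\varphi^*(j)}$ if $j\in\varphi(S)\setminus S$; $\bar\varphi(N_n)$ denotes $\bar\varphi(1,2,\dots,n)$. -}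

module Defs where

open import Algebra.Bundles using (CommutativeRing)
open import Data.Nat as ℕ using (ℕ; zero; suc; _∸_; _≡ᵇ_; _≤ᵇ_)
open import Data.Nat.Properties using (m∸n≤m)
open import Data.Fin as Fin using (Fin; toℕ; inject≤)
open import Data.Vec as Vec using (Vec; []; _∷_)
open import Data.List as List using (List; []; _∷_; filterᵇ; allFin; upTo; length; lookup)
open import Data.Maybe as Maybe using (Maybe; just; nothing; is-just; _>>=_)
open import Data.Bool using (Bool; true; false; _∧_; not; if_then_else_)
open import Function using (_∘_)

-- Indices are 0-based: Fin m = {0,…,m-1} stands for N_m = {1,…,m}
-- (the shift by one is harmless since only the order and the
-- identification of row index i with column index i matter).
-- A partial map is a vector v with v[i] = just c iff i ∈ S and φ(i) = c.

PMap : ℕ → ℕ → Set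
PMap m q = Vec (Maybe (Fin q)) m

allPMaps : ∀ m q → List (PMap m q)
allPMaps zero    q = [] ∷ []
allPMaps (suc m) q =
  List.concatMap (λ v → List.map (_∷ v) (nothing ∷ List.map just (allFin q)))
                 (allPMaps m q)

notIn : ∀ {m q} → Fin q → PMap m q → Bool
notIn c []             = true
notIn c (nothing ∷ v)  = notIn c v
notIn c (just d ∷ v)   = not (toℕ c ≡ᵇ toℕ d) ∧ notIn c v

isInj : ∀ {m q} → PMap m q → Bool
isInj []            = true
isInj (nothing ∷ v) = isInj v
isInj (just c ∷ v)  = notIn c v ∧ isInj v

-- ⋃_S Inj(S, N_q) for S ⊆ N_m
Inj : ∀ m q → List (PMap m q)
Inj m q = filterᵇ isInj (allPMaps m q)

domSize : ∀ {m q} → PMap m q → ℕ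
domSize []            = 0
domSize (nothing ∷ v) = domSize v
domSize (just _ ∷ v)  = suc (domSize v)

at : ∀ {m q} → PMap m q → ℕ → Maybe (Fin q)
at []      j       = nothing
at (x ∷ v) zero    = x
at (x ∷ v) (suc j) = at v j

inDom : ∀ {m q} → PMap m q → ℕ → Bool
inDom v j = is-just (at v j)

-- φ^t(j), where row index i is identified with column index i
iter : ∀ {m q} → PMap m q → ℕ → ℕ → Maybe ℕ
iter v zero    j = just j
iter v (suc t) j = at v j >>= λ c → iter v t (toℕ c)

eqM : Maybe ℕ → ℕ → Bool
eqM nothing  j = false
eqM (just y) j = y ≡ᵇ j

leM : ℕ → Maybe ℕ → Bool
leM j nothing  = true
leM j (just y) = j ≤ᵇ y

anyL : {A : Set} → (A → Bool) → List A → Bool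
anyL p []       = false
anyL p (x ∷ xs) = if p x then true else anyL p xs

allL : {A : Set} → (A → Bool) → List A → Bool
allL p []       = true
allL p (x ∷ xs) = p x ∧ allL p xs

-- j lies on a cycle of φ: φ^p(j) = j for some p ≥ 1 (p ≤ m suffices, cycles lie in S ⊆ N_m)
onCycle : ∀ {m q} → PMap m q → ℕ → Bool
onCycle {m} v j = anyL (λ t → eqM (iter v (suc t) j) j) (upTo m)

minOfOrbit : ∀ {m q} → PMap m q → ℕ → Bool
minOfOrbit {m} v j = allL (λ t → leM j (iter v (suc t) j)) (upTo m)

-- |φ| = number of cycles, each cycle C counted once via its least element
cycles : ∀ {m q} → PMap m q → ℕ
cycles {m} v = length (filterᵇ (λ j → onCycle v j ∧ minOfOrbit v j) (upTo m))

pre : ∀ {m n} → PMap m n → Fin n → Maybe (Fin m)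
pre []             j = nothing
pre (nothing ∷ v)  j = Maybe.map Fin.suc (pre v j)
pre (just c ∷ v)   j = if toℕ c ≡ᵇ toℕ j then just Fin.zero else Maybe.map Fin.suc (pre v j)

module Bar {m n : ℕ} (m≤n : m ℕ.≤ n) (v : PMap m n) where

  emb : Fin m → Fin n
  emb i = inject≤ i m≤n

  -- follow j_l = φ^{-1}(j_{l-1}) until leaving φ(S) (fuel n suffices)
  chase : ℕ → Fin m → Fin m
  chase zero    i = i
  chase (suc f) i with pre v (emb i)
  ... | nothing = i
  ... | just i′ = chase f i′

  phiStar : Fin n → Fin n
  phiStar j with pre v j
  ... | nothing = j
  ... | just i  = emb (chase n i)

  inImg : Fin n → Bool
  inImg j = is-just (pre v j)

  barN : List (Fin n)
  barN = List.map (λ j → if inImg j then phiStar j else j)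
                  (filterᵇ (λ j → not (inDom v (toℕ j))) (allFin n))

phiBar : ∀ {m n} → m ℕ.≤ n → PMap m n → List (Fin n)
phiBar m≤n v = Bar.barN m≤n v

supportAbove : ∀ {m q} → ℕ → PMap m q → Bool
supportAbove r v = allL (λ i → not (inDom v i)) (upTo r) ∧ not (domSize v ≡ᵇ 0)

-- A[N_r | c_1,…,c_s]  (r ≤ m, first r rows, columns in the given order)
subM : ∀ {a} {C : Set a} {m n r} → (Fin m → Fin n → C) → r ℕ.≤ m →
       (cols : List (Fin n)) → Fin r → Fin (length cols) → C
subM A r≤m cols i s = A (inject≤ i r≤m) (lookup cols s)

module Rook {c ℓ} (R : CommutativeRing c ℓ) where
  open CommutativeRing R

  sumL : List Carrier → Carrier
  sumL = List.foldr _+_ 0#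

  pow : Carrier → ℕ → Carrier
  pow a zero    = 1#
  pow a (suc k) = a * pow a k

  prodA : ∀ {m q} → (Fin m → Fin q → Carrier) → PMap m q → Carrier
  prodA A []            = 1#
  prodA A (nothing ∷ v) = prodA (A ∘ Fin.suc) v
  prodA A (just c ∷ v)  = A Fin.zero c * prodA (A ∘ Fin.suc) v

  rookCoeff : ∀ {m q} → Carrier → (Fin m → Fin q → Carrier) → ℕ → Carrier
  rookCoeff {m} {q} z A l =
    sumL (List.map (λ v → pow z (cycles v) * prodA A v)
                   (filterᵇ (λ v → domSize v ≡ᵇ l) (Inj m q)))

  rookPoly : ∀ {m q} → Carrier → Carrier → (Fin m → Fin q → Carrier) → Carrier
  rookPoly {m} x z A = sumL (List.map (λ l → rookCoeff z A l * pow x l) (upTo (suc m)))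

module Submission where

-- Split φ into its part ψ on the bottom rows N_m ∖ N_{m-k} and its part on the top rows N_{m-k}.
-- For a fixed injective ψ, following ψ backwards from a column outside S until leaving φ(S) (the
-- map φ^*) identifies the columns still available to the top rows with the columns φ̄(N_n), so the
-- top parts are exactly the injective maps τ of A[N_{m-k} | φ̄(N_n)].  A cycle of φ is either a
-- cycle of ψ or, once its excursions through the bottom rows are contracted, a cycle of τ; hence
-- |φ| = |ψ| + |τ|, the weight of φ factors, and summing over τ yields the rook polynomial of the
-- submatrix.  The bottom part ψ = ∅ contributes the last term.

open import Defs
open import Algebra.Bundles using (CommutativeRing)
open import Data.Bool using (Bool; true; false; T; _∧_; not; if_then_else_)
open import Data.Bool.Properties using (∧-comm; ∧-assoc; T-≡)
open import Data.Empty using (⊥; ⊥-elim)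
open import Data.Fin as Fin using (Fin; toℕ; _↑ˡ_; _↑ʳ_)
open import Data.Fin.Properties using (pigeonhole; toℕ-fromℕ<; toℕ<n; toℕ-injective; toℕ-inject≤; toℕ-↑ˡ)
open import Data.List as List using (List; []; _∷_; _++_; map; filterᵇ; allFin; applyUpTo; upTo; tabulate; length; lookup; concatMap)
import Data.List.Properties as Listₚ
open import Data.Maybe as Maybe using (Maybe; just; nothing; is-just; _>>=_)
open import Data.Nat as ℕ using (ℕ; zero; suc; _∸_; _≤_; _<_; z≤n; s≤s; _≡ᵇ_; _≤ᵇ_; _≤?_; _<?_)
import Data.Nat.Properties as ℕₚ
open import Data.Nat.Properties using (m∸n≤m)
open import Data.Product using (∃; _×_; _,_; proj₁; proj₂)
open import Data.Sum using (_⊎_; inj₁; inj₂)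
open import Data.Unit using (⊤; tt)
open import Data.Vec as Vec using (Vec; []; _∷_)
open import Function using (_∘_; id; Equivalence)
open import Relation.Binary.PropositionalEquality hiding ([_])
open import Relation.Nullary using (yes; no)

just≢nothing : ∀ {A : Set} {a : A} → just a ≢ nothing
just≢nothing ()

just-injective : ∀ {A : Set} {a b : A} → just a ≡ just b → a ≡ b
just-injective refl = refl

true≢false : true ≡ false → ⊥
true≢false ()

≡true⇒T : ∀ {b} → b ≡ true → T b
≡true⇒T = Equivalence.from T-≡

T⇒≡true : ∀ {b} → T b → b ≡ true
T⇒≡true = Equivalence.to T-≡

≡ᵇ-sound : ∀ a b → (a ≡ᵇ b) ≡ true → a ≡ b
≡ᵇ-sound a b e = ℕₚ.≡ᵇ⇒≡ a b (≡true⇒T e)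

≡ᵇ-complete : ∀ a b → a ≡ b → (a ≡ᵇ b) ≡ true
≡ᵇ-complete a b e = T⇒≡true (ℕₚ.≡⇒≡ᵇ a b e)

≤ᵇ-sound : ∀ a b → (a ≤ᵇ b) ≡ true → a ≤ b
≤ᵇ-sound a b e = ℕₚ.≤ᵇ⇒≤ a b (≡true⇒T e)

≤ᵇ-complete : ∀ a b → a ≤ b → (a ≤ᵇ b) ≡ true
≤ᵇ-complete a b e = T⇒≡true (ℕₚ.≤⇒≤ᵇ e)

∧-trueˡ : ∀ {a b} → (a ∧ b) ≡ true → a ≡ true
∧-trueˡ {true} e = refl

∧-trueʳ : ∀ {a b} → (a ∧ b) ≡ true → b ≡ true
∧-trueʳ {true} e = e

∧-true : ∀ {a b} → a ≡ true → b ≡ true → (a ∧ b) ≡ true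
∧-true refl refl = refl

∧-false : ∀ {a b : Bool} → (a ≡ true → b ≡ true → ⊥) → (a ∧ b) ≡ false
∧-false {true} {true} h = ⊥-elim (h refl refl)
∧-false {true} {false} h = refl
∧-false {false} h = refl

Bool-ext : ∀ {a b : Bool} → (a ≡ true → b ≡ true) → (b ≡ true → a ≡ true) → a ≡ b
Bool-ext {true} {true} f g = refl
Bool-ext {true} {false} f g = sym (f refl)
Bool-ext {false} {true} f g = g refl
Bool-ext {false} {false} f g = refl

not-is-just : ∀ {A : Set} (x : Maybe A) → not (is-just x) ≡ true → x ≡ nothing
not-is-just nothing e = refl

anyL-sound : ∀ (p : ℕ → Bool) (f : ℕ → ℕ) N → anyL p (applyUpTo f N) ≡ true →
             ∃ λ i → i < N × p (f i) ≡ true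
anyL-sound p f (suc N) e with p (f 0) in e0
... | true = 0 , s≤s z≤n , e0
... | false with anyL-sound p (f ∘ suc) N e
...   | i , lt , ei = suc i , s≤s lt , ei

anyL-complete : ∀ (p : ℕ → Bool) (f : ℕ → ℕ) N i → i < N → p (f i) ≡ true →
                anyL p (applyUpTo f N) ≡ true
anyL-complete p f (suc N) zero lt e rewrite e = refl
anyL-complete p f (suc N) (suc i) (s≤s lt) e with p (f 0)
... | true = refl
... | false = anyL-complete p (f ∘ suc) N i lt e

allL-sound : ∀ (p : ℕ → Bool) (f : ℕ → ℕ) N → allL p (applyUpTo f N) ≡ true →
             ∀ i → i < N → p (f i) ≡ true
allL-sound p f (suc N) e zero lt = ∧-trueˡ e
allL-sound p f (suc N) e (suc i) (s≤s lt) = allL-sound p (f ∘ suc) N (∧-trueʳ {p (f 0)} e) i lt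

allL-complete : ∀ (p : ℕ → Bool) (f : ℕ → ℕ) N → (∀ i → i < N → p (f i) ≡ true) →
                allL p (applyUpTo f N) ≡ true
allL-complete p f zero h = refl
allL-complete p f (suc N) h =
  ∧-true (h 0 (s≤s z≤n)) (allL-complete p (f ∘ suc) N (λ i lt → h (suc i) (s≤s lt)))

module _ where
  open import Data.Nat using (_+_; _*_)
  open import Data.Nat.Properties

  InDom : ∀ {m q} → PMap m q → ℕ → Set
  InDom v y = ∃ λ c → at v y ≡ just c

  at-< : ∀ {m q} (v : PMap m q) j {c} → at v j ≡ just c → j < m
  at-< (x ∷ v) zero    e = s≤s z≤n
  at-< (x ∷ v) (suc j) e = s≤s (at-< v j e)

  at-≥ : ∀ {m q} (v : PMap m q) j → m ≤ j → at v j ≡ nothing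
  at-≥ []      j       le        = refl
  at-≥ (x ∷ v) (suc j) (s≤s le) = at-≥ v j le

  collision : ∀ {m} (g : Fin (suc m) → ℕ) → (∀ t → g t < m) → ∃ λ a → ∃ λ b → toℕ a < toℕ b × g a ≡ g b
  collision {m} g bound = a , b , a<b , same
    where
    g′ : Fin (suc m) → Fin m
    g′ t = Fin.fromℕ< (bound t)
    repeat = pigeonhole (n<1+n m) g′
    a = proj₁ repeat
    b = proj₁ (proj₂ repeat)
    a<b = proj₁ (proj₂ (proj₂ repeat))
    same : g a ≡ g b
    same = trans (sym (toℕ-fromℕ< _)) (trans (cong toℕ (proj₂ (proj₂ (proj₂ repeat)))) (toℕ-fromℕ< _))

  module _ {m q : ℕ} (v : PMap m q) where

    iter-+ : ∀ u w j → iter v (u + w) j ≡ (iter v u j >>= iter v w)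
    iter-+ zero    w j = refl
    iter-+ (suc u) w j with at v j
    ... | nothing = refl
    ... | just c  = iter-+ u w (toℕ c)

    iter-sucʳ : ∀ t j → iter v (suc t) j ≡ (iter v t j >>= iter v 1)
    iter-sucʳ t j = trans (cong (λ k → iter v k j) (+-comm 1 t)) (iter-+ t 1 j)

    iter-∉dom : ∀ j t → at v j ≡ nothing → iter v (suc t) j ≡ nothing
    iter-∉dom j t e rewrite e = refl

    iter-≥ : ∀ t j {y} → m ≤ j → iter v t j ≡ just y → t ≡ 0 × y ≡ j
    iter-≥ zero    j le refl = refl , refl
    iter-≥ (suc t) j le e rewrite at-≥ v j le = ⊥-elim (just≢nothing (sym e))

    iter-suc-∈dom : ∀ t j {y} → iter v (suc t) j ≡ just y → InDom v j
    iter-suc-∈dom t j e with at v j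
    ... | just c  = c , refl
    ... | nothing = ⊥-elim (just≢nothing (sym e))

    iter-step : ∀ t j {c y} → at v j ≡ just c → iter v (suc t) j ≡ y → iter v t (toℕ c) ≡ y
    iter-step t j e e′ rewrite e = e′

    iter-step⁻ : ∀ t j {c y} → at v j ≡ just c → iter v t (toℕ c) ≡ y → iter v (suc t) j ≡ y
    iter-step⁻ t j e e′ rewrite e = e′

    iter-snoc : ∀ t y {u c} → iter v t y ≡ just u → at v u ≡ just c → iter v (suc t) y ≡ just (toℕ c)
    iter-snoc t y e e′ =
      trans (iter-sucʳ t y) (trans (cong (_>>= iter v 1) e) (cong (_>>= (λ c → just (toℕ c))) e′))

    iter-snoc⁻ : ∀ t y {z} → iter v (suc t) y ≡ just z →
                 ∃ λ u → iter v t y ≡ just u × ∃ λ c → at v u ≡ just c × toℕ c ≡ z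
    iter-snoc⁻ t y {z} e with iter v t y in e₁
    ... | nothing = ⊥-elim (just≢nothing (trans (sym e) (trans (iter-sucʳ t y) (cong (_>>= iter v 1) e₁))))
    ... | just u with at v u in e₂
    ...   | nothing = ⊥-elim (just≢nothing (trans (sym e) (trans (iter-sucʳ t y)
                        (trans (cong (_>>= iter v 1) e₁) (cong (_>>= (λ c → just (toℕ c))) e₂)))))
    ...   | just c = u , refl , c , e₂ , just-injective (trans (sym (iter-snoc t y e₁ e₂)) e)

    Periodic : ℕ → Set
    Periodic j = ∃ λ P → iter v (suc P) j ≡ just j

    OrbitMinimum : ℕ → Set
    OrbitMinimum j = ∀ t y → iter v t j ≡ just y → j ≤ y

    CycleLeader : ℕ → Set
    CycleLeader j = Periodic j × OrbitMinimum j

    module _ {P j : ℕ} (period : iter v (suc P) j ≡ just j) where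

      iter-period-* : ∀ a → iter v (a * suc P) j ≡ just j
      iter-period-* zero    = refl
      iter-period-* (suc a) = trans (iter-+ (suc P) (a * suc P) j)
        (trans (cong (_>>= iter v (a * suc P)) period) (iter-period-* a))

      orbit-periodic : ∀ t {y} → iter v t j ≡ just y → iter v (suc P) y ≡ just y
      orbit-periodic t {y} ey = begin
        iter v (suc P) y                 ≡⟨ cong (_>>= iter v (suc P)) ey ⟨
        (iter v t j >>= iter v (suc P))  ≡⟨ iter-+ t (suc P) j ⟨
        iter v (t + suc P) j             ≡⟨ cong (λ k → iter v k j) (+-comm t (suc P)) ⟩
        iter v (suc P + t) j             ≡⟨ iter-+ (suc P) t j ⟩
        (iter v (suc P) j >>= iter v t)  ≡⟨ cong (_>>= iter v t) period ⟩
        iter v t j                       ≡⟨ ey ⟩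
        just y                           ∎
        where open ≡-Reasoning

      orbit-defined : ∀ t → ∃ λ y → iter v t j ≡ just y
      orbit-defined zero = j , refl
      orbit-defined (suc t) with orbit-defined t
      ... | y , ey with iter-suc-∈dom P y (orbit-periodic t ey)
      ...   | c , ec = toℕ c , iter-snoc t j ey ec

      orbit-< : ∀ t {y} → iter v t j ≡ just y → y < m
      orbit-< t ey = at-< v _ (proj₂ (iter-suc-∈dom P _ (orbit-periodic t ey)))

      period-≤ : ∃ λ P′ → P′ < m × iter v (suc P′) j ≡ just j
      period-≤ = shorten (b ∸ a) (m<n⇒0<n∸m a<b) (≤-trans (m∸n≤m b a) b≤m) returns
        where
        point : ℕ → ℕ
        point t = proj₁ (orbit-defined t)
        point≡ : ∀ t → iter v t j ≡ just (point t)
        point≡ t = proj₂ (orbit-defined t)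
        repeat = collision (point ∘ toℕ) (λ t → orbit-< (toℕ t) (point≡ (toℕ t)))
        a = toℕ (proj₁ repeat)
        b = toℕ (proj₁ (proj₂ repeat))
        a<b : a < b
        a<b = proj₁ (proj₂ (proj₂ repeat))
        b≤m : b ≤ m
        b≤m = ≤-pred (toℕ<n (proj₁ (proj₂ repeat)))
        D = b ∸ a
        E = a * suc P ∸ a
        back-to-j : iter v E (point a) ≡ just j
        back-to-j = begin
          iter v E (point a)                ≡⟨ cong (_>>= iter v E) (point≡ a) ⟨
          (iter v a j >>= iter v E)         ≡⟨ iter-+ a E j ⟨
          iter v (a + E) j                  ≡⟨ cong (λ k → iter v k j) (m+[n∸m]≡n (m≤m*n a (suc P))) ⟩
          iter v (a * suc P) j              ≡⟨ iter-period-* a ⟩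
          just j                            ∎
          where open ≡-Reasoning
        loop : iter v D (point a) ≡ just (point a)
        loop = begin
          iter v D (point a)                ≡⟨ cong (_>>= iter v D) (point≡ a) ⟨
          (iter v a j >>= iter v D)         ≡⟨ iter-+ a D j ⟨
          iter v (a + D) j                  ≡⟨ cong (λ k → iter v k j) (m+[n∸m]≡n (<⇒≤ a<b)) ⟩
          iter v b j                        ≡⟨ point≡ b ⟩
          just (point b)                    ≡⟨ cong just (proj₂ (proj₂ (proj₂ repeat))) ⟨
          just (point a)                    ∎
          where open ≡-Reasoning
        returns : iter v D j ≡ just j
        returns = begin
          iter v D j                        ≡⟨ cong (_>>= iter v D) back-to-j ⟨
          (iter v E (point a) >>= iter v D) ≡⟨ iter-+ E D (point a) ⟨
          iter v (E + D) (point a)          ≡⟨ cong (λ k → iter v k (point a)) (+-comm E D) ⟩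
          iter v (D + E) (point a)          ≡⟨ iter-+ D E (point a) ⟩
          (iter v D (point a) >>= iter v E) ≡⟨ cong (_>>= iter v E) loop ⟩
          iter v E (point a)                ≡⟨ back-to-j ⟩
          just j                            ∎
          where open ≡-Reasoning
        shorten : ∀ d → 0 < d → d ≤ m → iter v d j ≡ just j → ∃ λ P′ → P′ < m × iter v (suc P′) j ≡ just j
        shorten (suc d) _ le e = d , le , e

    isCycleLeader : ℕ → Bool
    isCycleLeader j = onCycle v j ∧ minOfOrbit v j

    onCycle-sound : ∀ j → onCycle v j ≡ true → ∃ λ P → P < m × iter v (suc P) j ≡ just j
    onCycle-sound j e with anyL-sound (λ t → eqM (iter v (suc t) j) j) id m e
    ... | P , lt , e′ with iter v (suc P) j in ei
    ...   | just y = P , lt , trans ei (cong just (≡ᵇ-sound y j e′))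

    onCycle-complete : ∀ j → Periodic j → onCycle v j ≡ true
    onCycle-complete j (P , period) with period-≤ {P} period
    ... | P′ , lt , e = anyL-complete (λ t → eqM (iter v (suc t) j) j) id m P′ lt
                         (trans (cong (λ w → eqM w j) e) (≡ᵇ-complete j j refl))

    minOfOrbit-complete : ∀ j → OrbitMinimum j → minOfOrbit v j ≡ true
    minOfOrbit-complete j min = allL-complete (λ t → leM j (iter v (suc t) j)) id m below
      where
      below : ∀ i → i < m → leM j (iter v (suc i) j) ≡ true
      below i _ with iter v (suc i) j in e
      ... | nothing = refl
      ... | just y  = ≤ᵇ-complete j y (min (suc i) y e)

    -- minOfOrbit only inspects the first m iterates; periodicity with a period < m covers the rest.
    minOfOrbit-sound : ∀ j → onCycle v j ≡ true → minOfOrbit v j ≡ true → OrbitMinimum j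
    minOfOrbit-sound j cyc min with onCycle-sound j cyc
    ... | P , P<m , period = λ t y e → go t t ≤-refl y e
      where
      checked : ∀ i → i < m → leM j (iter v (suc i) j) ≡ true
      checked = allL-sound (λ t → leM j (iter v (suc t) j)) id m min
      go : ∀ N t → t ≤ N → ∀ y → iter v t j ≡ just y → j ≤ y
      go N zero le y e = ≤-reflexive (just-injective e)
      go (suc N) (suc t) le y e with t ≤? P
      ... | yes t≤P = ≤ᵇ-sound j y (subst (λ w → leM j w ≡ true) e (checked t (≤-<-trans t≤P P<m)))
      ... | no t≰P = go N u (≤-trans (m∸n≤m t P) (≤-pred le)) y earlier
        where
        u = suc t ∸ suc P
        earlier : iter v u j ≡ just y
        earlier = begin
          iter v u j                       ≡⟨ cong (_>>= iter v u) period ⟨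
          (iter v (suc P) j >>= iter v u)  ≡⟨ iter-+ (suc P) u j ⟨
          iter v (suc P + u) j             ≡⟨ cong (λ k → iter v k j) (m+[n∸m]≡n (s≤s (<⇒≤ (≰⇒> t≰P)))) ⟩
          iter v (suc t) j                 ≡⟨ e ⟩
          just y                           ∎
          where open ≡-Reasoning

    isCycleLeader-sound : ∀ j → isCycleLeader j ≡ true → CycleLeader j
    isCycleLeader-sound j e with onCycle-sound j (∧-trueˡ e)
    ... | P , _ , period = (P , period) , minOfOrbit-sound j (∧-trueˡ e) (∧-trueʳ {onCycle v j} e)

    isCycleLeader-complete : ∀ j → CycleLeader j → isCycleLeader j ≡ true
    isCycleLeader-complete j (cyc , min) = ∧-true (onCycle-complete j cyc) (minOfOrbit-complete j min)

module _ where
  open import Data.Nat using (_+_)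
  open import Data.Nat.Properties

  count : (ℕ → Bool) → List ℕ → ℕ
  count p xs = length (filterᵇ p xs)

  count-++ : ∀ p xs ys → count p (xs ++ ys) ≡ count p xs + count p ys
  count-++ p xs ys = trans (cong length (Listₚ.filter-++ _ xs ys)) (Listₚ.length-++ (filterᵇ p xs))

  count-cong : ∀ p q (f : ℕ → ℕ) N → (∀ i → i < N → p (f i) ≡ q (f i)) →
               count p (applyUpTo f N) ≡ count q (applyUpTo f N)
  count-cong p q f zero    h = refl
  count-cong p q f (suc N) h with p (f 0) | q (f 0) | h 0 (s≤s z≤n)
                                | count-cong p q (f ∘ suc) N (λ i lt → h (suc i) (s≤s lt))
  ... | true  | .true  | refl | ih = cong suc ih
  ... | false | .false | refl | ih = ih

  count-none : ∀ p N → (∀ i → i < N → p i ≡ false) → count p (upTo N) ≡ 0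
  count-none p N h = trans (count-cong p (λ _ → false) id N h) (none (upTo N))
    where
    none : ∀ xs → count (λ _ → false) xs ≡ 0
    none []       = refl
    none (x ∷ xs) = none xs

  applyUpTo-+ : ∀ (f : ℕ → ℕ) r s → applyUpTo f (r + s) ≡ applyUpTo f r ++ applyUpTo (λ i → f (r + i)) s
  applyUpTo-+ f zero    s = refl
  applyUpTo-+ f (suc r) s = cong (f 0 ∷_) (applyUpTo-+ (f ∘ suc) r s)

  count-split : ∀ p {r m} → r ≤ m → count p (upTo m) ≡ count p (upTo r) + count p (applyUpTo (r +_) (m ∸ r))
  count-split p {r} {m} r≤m =
    trans (cong (count p ∘ upTo) (sym (m+[n∸m]≡n r≤m))) (trans (cong (count p) (applyUpTo-+ id r (m ∸ r)))
      (count-++ p (upTo r) _))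

  isCycleLeader-≡ : ∀ {m m′ q q′} (v : PMap m q) (w : PMap m′ q′) j →
                    (CycleLeader v j → CycleLeader w j) → (CycleLeader w j → CycleLeader v j) →
                    isCycleLeader v j ≡ isCycleLeader w j
  isCycleLeader-≡ v w j to from =
    Bool-ext (λ e → isCycleLeader-complete w j (to (isCycleLeader-sound v j e)))
             (λ e → isCycleLeader-complete v j (from (isCycleLeader-sound w j e)))

  PathAbove : ∀ {m q} → PMap m q → ℕ → ℕ → ℕ → Set
  PathAbove ψ r start end =
    ∃ λ a → iter ψ a start ≡ just end × (∀ a′ → a′ < a → ∃ λ y → iter ψ a′ start ≡ just y × r ≤ y)

  StaysAbove : ∀ {m q} → PMap m q → ℕ → ℕ → ℕ → Set
  StaysAbove v r a i = iter v a i ≡ nothing ⊎ ∃ λ y → iter v a i ≡ just y × r ≤ y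

  -- v is glued from τ on the top rows (values translated by f) and ψ on the bottom rows.
  -- Each column f pos leads under ψ to a point cn outside dom ψ, which is the row pos itself when
  -- pos is a top row.
  module GluedCycles {m n r p : ℕ} (v ψ : PMap m n) (τ : PMap r p) (f : Fin p → Fin n) (r≤m : r ≤ m)
    (v-top : ∀ j → j < r → at v j ≡ Maybe.map f (at τ j))
    (v-bottom : ∀ j → r ≤ j → at v j ≡ at ψ j)
    (ψ-top : ∀ j → j < r → at ψ j ≡ nothing)
    (return : ∀ pos → ∃ λ cn → (toℕ pos < r → cn ≡ toℕ pos) × (r ≤ toℕ pos → r ≤ cn) ×
                               at ψ cn ≡ nothing × PathAbove ψ r (toℕ (f pos)) cn) where

    at-ψ⇒v : ∀ j {c} → at ψ j ≡ just c → at v j ≡ just c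
    at-ψ⇒v j e with j <? r
    ... | yes lt  = ⊥-elim (just≢nothing (trans (sym e) (ψ-top j lt)))
    ... | no nlt = trans (v-bottom j (≮⇒≥ nlt)) e

    iter-ψ⇒v : ∀ t j {y} → iter ψ t j ≡ just y → iter v t j ≡ just y
    iter-ψ⇒v zero    j e = e
    iter-ψ⇒v (suc t) j e with at ψ j in eψ
    ... | just c rewrite at-ψ⇒v j eψ = iter-ψ⇒v t (toℕ c) e

    -- From a top row i, v either reaches τ i (a top row) after a detour through the bottom rows,
    -- or never comes back to the top rows.
    TopStep : ℕ → Set
    TopStep i = (∃ λ pos → at τ i ≡ just pos × toℕ pos < r ×
                  ∃ λ a → iter v (suc a) i ≡ just (toℕ pos) ×
                    (∀ e → e < a → ∃ λ y → iter v (suc e) i ≡ just y × r ≤ y))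
              ⊎ ((∀ pos → at τ i ≡ just pos → r ≤ toℕ pos) × (∀ a → StaysAbove v r (suc a) i))

    topStep : ∀ i → i < r → TopStep i
    topStep i lt with at τ i in eτ
    ... | nothing = inj₂ ((λ pos ()) , λ a → inj₁ (iter-∉dom v i a (trans (v-top i lt) (cong (Maybe.map f) eτ))))
    ... | just pos with return pos | v-top i lt
    ...   | cn , cn-top , cn-bottom , cn∉dom , a , path , above | v-i rewrite eτ with toℕ pos <? r
    ...     | yes pos<r = inj₁ (pos , refl , pos<r , a ,
                             trans (iter-step⁻ v a i v-i (iter-ψ⇒v a _ path)) (cong just (cn-top pos<r)) ,
                             λ e e<a → let (y , ey , r≤y) = above e e<a in y , iter-step⁻ v e i v-i (iter-ψ⇒v e _ ey) , r≤y)
    ...     | no pos≮r = inj₂ ((λ { _ refl → ≮⇒≥ pos≮r }) , stays)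
      where
      r≤cn : r ≤ cn
      r≤cn = cn-bottom (≮⇒≥ pos≮r)
      stays : ∀ a′ → StaysAbove v r (suc a′) i
      stays a′ with a′ <? a
      ... | yes a′<a = let (y , ey , r≤y) = above a′ a′<a in inj₂ (y , iter-step⁻ v a′ i v-i (iter-ψ⇒v a′ _ ey) , r≤y)
      ... | no a′≮a with a′ ≟ a
      ...   | yes refl = inj₂ (cn , iter-step⁻ v a i v-i (iter-ψ⇒v a _ path) , r≤cn)
      ...   | no a′≢a = inj₁ (iter-step⁻ v a′ i v-i dies)
        where
        a<a′ : a < a′
        a<a′ = ≤∧≢⇒< (≮⇒≥ a′≮a) (λ e → a′≢a (sym e))
        d = ℕ.pred (a′ ∸ a)
        dies : iter v a′ (toℕ (f pos)) ≡ nothing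
        dies = begin
          iter v a′ (toℕ (f pos))                       ≡⟨ cong (λ k → iter v k (toℕ (f pos))) a′≡ ⟩
          iter v (a + suc d) (toℕ (f pos))              ≡⟨ iter-+ v a (suc d) _ ⟩
          (iter v a (toℕ (f pos)) >>= iter v (suc d))   ≡⟨ cong (_>>= iter v (suc d)) (iter-ψ⇒v a _ path) ⟩
          iter v (suc d) cn                             ≡⟨ iter-∉dom v cn d (trans (v-bottom cn r≤cn) cn∉dom) ⟩
          nothing                                       ∎
          where
          open ≡-Reasoning
          a′≡ : a′ ≡ a + suc d
          a′≡ = sym (trans (cong (a +_) (suc-pred (a′ ∸ a) {{ℕ.>-nonZero (m<n⇒0<n∸m a<a′)}})) (m+[n∸m]≡n (<⇒≤ a<a′)))

    iter-τ⇒v : ∀ t j {y} → j < r → iter τ t j ≡ just y → y < r →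
               ∃ λ a → iter v a j ≡ just y × (0 < t → 0 < a)
    iter-τ⇒v zero j lt e y<r = 0 , e , λ ()
    iter-τ⇒v (suc t) j lt e y<r with topStep j lt
    ... | inj₁ (pos , eτ , pos<r , a , ev , _) with iter-τ⇒v t (toℕ pos) pos<r (iter-step τ t j eτ e) y<r
    ...   | a₂ , ev₂ , _ = suc a + a₂ , trans (iter-+ v (suc a) a₂ j) (trans (cong (_>>= iter v a₂) ev) ev₂) , λ _ → s≤s z≤n
    iter-τ⇒v (suc t) j lt e y<r | inj₂ (r≤τ , _) with at τ j in eτ
    ... | nothing  = ⊥-elim (just≢nothing (sym e))
    ... | just pos with iter-≥ τ t (toℕ pos) (r≤τ pos refl) e
    ...   | _ , refl = ⊥-elim (<⇒≱ y<r (r≤τ pos refl))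

    iter-v⇒τ : ∀ N a j {y} → a ≤ N → j < r → iter v a j ≡ just y → y < r →
               ∃ λ t → iter τ t j ≡ just y × (0 < a → 0 < t)
    iter-v⇒τ N zero j le lt e y<r = 0 , e , λ ()
    iter-v⇒τ (suc N) (suc a₀) j le lt e y<r with topStep j lt
    ... | inj₂ (_ , stays) with stays a₀
    ...   | inj₁ dead = ⊥-elim (just≢nothing (trans (sym e) dead))
    ...   | inj₂ (y′ , ey′ , r≤y′) = ⊥-elim (<⇒≱ y<r (subst (r ≤_) (just-injective (trans (sym ey′) e)) r≤y′))
    iter-v⇒τ (suc N) (suc a₀) j le lt e y<r | inj₁ (pos , eτ , pos<r , a₁ , ev₁ , above) with a₀ <? a₁
    ... | yes a₀<a₁ = let (y′ , ey′ , r≤y′) = above a₀ a₀<a₁ in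
                      ⊥-elim (<⇒≱ y<r (subst (r ≤_) (just-injective (trans (sym ey′) e)) r≤y′))
    ... | no a₀≮a₁ = suc t′ , iter-step⁻ τ t′ j eτ (proj₁ (proj₂ ih)) , λ _ → s≤s z≤n
      where
      d = a₀ ∸ a₁
      rest : iter v d (toℕ pos) ≡ just _
      rest = begin
        iter v d (toℕ pos)                  ≡⟨ cong (_>>= iter v d) ev₁ ⟨
        (iter v (suc a₁) j >>= iter v d)    ≡⟨ iter-+ v (suc a₁) d j ⟨
        iter v (suc (a₁ + d)) j             ≡⟨ cong (λ k → iter v (suc k) j) (m+[n∸m]≡n (≮⇒≥ a₀≮a₁)) ⟩
        iter v (suc a₀) j                   ≡⟨ e ⟩
        just _                              ∎
        where open ≡-Reasoning
      ih = iter-v⇒τ N d (toℕ pos) (≤-trans (m∸n≤m a₀ a₁) (≤-pred le)) pos<r rest y<r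
      t′ = proj₁ ih

    leader-v⇒τ : ∀ j → j < r → CycleLeader v j → CycleLeader τ j
    leader-v⇒τ j lt ((P , eP) , min) = periodic , min′
      where
      periodic : Periodic τ j
      periodic with iter-v⇒τ (suc P) (suc P) j ≤-refl lt eP lt
      ... | suc t , et , _ = t , et
      ... | zero  , _  , pos = ⊥-elim (<-irrefl refl (pos (s≤s z≤n)))
      min′ : OrbitMinimum τ j
      min′ t y e with y <? r
      ... | yes y<r = let (a , ea , _) = iter-τ⇒v t j lt e y<r in min a y ea
      ... | no y≮r = <⇒≤ (<-≤-trans lt (≮⇒≥ y≮r))

    leader-τ⇒v : ∀ j → j < r → CycleLeader τ j → CycleLeader v j
    leader-τ⇒v j lt ((P , eP) , min) = periodic , min′
      where
      periodic : Periodic v j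
      periodic with iter-τ⇒v (suc P) j lt eP lt
      ... | suc a , ea , _ = a , ea
      ... | zero  , _  , pos = ⊥-elim (<-irrefl refl (pos (s≤s z≤n)))
      min′ : OrbitMinimum v j
      min′ a y e with y <? r
      ... | yes y<r = let (t , et , _) = iter-v⇒τ a a j ≤-refl lt e y<r in min t y et
      ... | no y≮r = <⇒≤ (<-≤-trans lt (≮⇒≥ y≮r))

    leader-ψ⇒v : ∀ j → CycleLeader ψ j → CycleLeader v j
    leader-ψ⇒v j ((P , eP) , min) = (P , iter-ψ⇒v (suc P) j eP) , min′
      where
      min′ : OrbitMinimum v j
      min′ t y e with orbit-defined ψ {P} eP t
      ... | y′ , ey′ with just-injective (trans (sym (iter-ψ⇒v t j ey′)) e)
      ...   | refl = min t y′ ey′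

    -- a cycle of v through a bottom leader never visits the top rows, so ψ follows it
    leader-v⇒ψ : ∀ j → r ≤ j → CycleLeader v j → CycleLeader ψ j
    leader-v⇒ψ j r≤j ((P , eP) , min) = (P , trans (same (suc P)) eP) , λ t y e → min t y (trans (sym (same t)) e)
      where
      same : ∀ t → iter ψ t j ≡ iter v t j
      same zero = refl
      same (suc t) with orbit-defined v {P} eP t
      ... | y , ey = begin
        iter ψ (suc t) j            ≡⟨ iter-sucʳ ψ t j ⟩
        (iter ψ t j >>= iter ψ 1)   ≡⟨ cong (_>>= iter ψ 1) (trans (same t) ey) ⟩
        iter ψ 1 y                  ≡⟨ cong (_>>= (λ c → just (toℕ c))) (v-bottom y (≤-trans r≤j (min t y ey))) ⟨
        iter v 1 y                  ≡⟨ cong (_>>= iter v 1) ey ⟨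
        (iter v t j >>= iter v 1)   ≡⟨ iter-sucʳ v t j ⟨
        iter v (suc t) j            ∎
        where open ≡-Reasoning

    cycles-glued : cycles v ≡ cycles ψ + cycles τ
    cycles-glued = begin
      cycles v                                                      ≡⟨ count-split (isCycleLeader v) r≤m ⟩
      count (isCycleLeader v) (upTo r) + count (isCycleLeader v) bottom
        ≡⟨ cong₂ _+_ (count-cong _ _ id r (λ j lt → isCycleLeader-≡ v τ j (leader-v⇒τ j lt) (leader-τ⇒v j lt)))
                     (count-cong _ _ (r +_) (m ∸ r) (λ i _ → isCycleLeader-≡ v ψ (r + i)
                        (leader-v⇒ψ (r + i) (m≤m+n r i)) (leader-ψ⇒v (r + i)))) ⟩
      cycles τ + count (isCycleLeader ψ) bottom                     ≡⟨ +-comm (cycles τ) _ ⟩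
      count (isCycleLeader ψ) bottom + cycles τ                     ≡⟨ cong (λ k → k + count (isCycleLeader ψ) bottom + cycles τ) no-top-leaders ⟨
      count (isCycleLeader ψ) (upTo r) + count (isCycleLeader ψ) bottom + cycles τ
                                                                    ≡⟨ cong (_+ cycles τ) (count-split (isCycleLeader ψ) r≤m) ⟨
      cycles ψ + cycles τ                                           ∎
      where
      open ≡-Reasoning
      bottom = applyUpTo (r +_) (m ∸ r)
      no-top-leaders : count (isCycleLeader ψ) (upTo r) ≡ 0
      no-top-leaders = count-none (isCycleLeader ψ) r λ j lt → ∧-false λ cyc _ →
        let (P , _ , eP) = onCycle-sound ψ j cyc in just≢nothing (trans (sym eP) (iter-∉dom ψ j P (ψ-top j lt)))

module _ where
  open import Data.Nat using (_+_)
  open import Data.Nat.Properties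

  map-suc-just : ∀ {k} (x : Maybe (Fin k)) {i : Fin (suc k)} → Maybe.map Fin.suc x ≡ just i →
                 ∃ λ i′ → i ≡ Fin.suc i′ × x ≡ just i′
  map-suc-just (just i′) refl = i′ , refl , refl

  map-suc-nothing : ∀ {k} (x : Maybe (Fin k)) → Maybe.map Fin.suc x ≡ nothing → x ≡ nothing
  map-suc-nothing nothing refl = refl

  pre-sound : ∀ {m n} (w : PMap m n) c {i} → pre w c ≡ just i → at w (toℕ i) ≡ just c
  pre-sound [] c ()
  pre-sound (nothing ∷ w) c e with map-suc-just (pre w c) e
  ... | i′ , refl , e′ = pre-sound w c e′
  pre-sound (just d ∷ w) c e with toℕ d ≡ᵇ toℕ c in ed
  ... | true with e
  ...   | refl = cong just (toℕ-injective (≡ᵇ-sound _ _ ed))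
  pre-sound (just d ∷ w) c e | false with map-suc-just (pre w c) e
  ...   | i′ , refl , e′ = pre-sound w c e′

  pre-nothing : ∀ {m n} (w : PMap m n) c → pre w c ≡ nothing → ∀ i → at w i ≢ just c
  pre-nothing (nothing ∷ w) c e zero ()
  pre-nothing (nothing ∷ w) c e (suc i) = pre-nothing w c (map-suc-nothing (pre w c) e) i
  pre-nothing (just d ∷ w) c e i ea with toℕ d ≡ᵇ toℕ c in ed
  pre-nothing (just d ∷ w) c () i ea | true
  pre-nothing (just d ∷ w) c e zero refl | false = true≢false (trans (sym (≡ᵇ-complete (toℕ d) (toℕ d) refl)) ed)
  pre-nothing (just d ∷ w) c e (suc i) ea | false = pre-nothing w c (map-suc-nothing (pre w c) e) i ea

  notIn-sound : ∀ {m n} (w : PMap m n) c → notIn c w ≡ true → ∀ i → at w i ≢ just c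
  notIn-sound (nothing ∷ w) c e zero ()
  notIn-sound (nothing ∷ w) c e (suc i) = notIn-sound w c e i
  notIn-sound (just d ∷ w) c e zero refl with toℕ d ≡ᵇ toℕ d in ed
  ... | true = true≢false (sym e)
  ... | false = true≢false (trans (sym (≡ᵇ-complete (toℕ d) (toℕ d) refl)) ed)
  notIn-sound (just d ∷ w) c e (suc i) = notIn-sound w c (∧-trueʳ {not (toℕ c ≡ᵇ toℕ d)} e) i

  notIn-complete : ∀ {m n} (w : PMap m n) c → (∀ i → at w i ≢ just c) → notIn c w ≡ true
  notIn-complete [] c h = refl
  notIn-complete (nothing ∷ w) c h = notIn-complete w c (h ∘ suc)
  notIn-complete (just d ∷ w) c h with toℕ c ≡ᵇ toℕ d in ed
  ... | true = ⊥-elim (h zero (cong just (toℕ-injective (sym (≡ᵇ-sound _ _ ed)))))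
  ... | false = notIn-complete w c (h ∘ suc)

  pre-∉image : ∀ {m n} (w : PMap m n) c → (∀ i → at w i ≢ just c) → pre w c ≡ nothing
  pre-∉image [] c h = refl
  pre-∉image (nothing ∷ w) c h = cong (Maybe.map Fin.suc) (pre-∉image w c (h ∘ suc))
  pre-∉image (just d ∷ w) c h with toℕ d ≡ᵇ toℕ c in ed
  ... | true = ⊥-elim (h zero (cong just (toℕ-injective (≡ᵇ-sound _ _ ed))))
  ... | false = cong (Maybe.map Fin.suc) (pre-∉image w c (h ∘ suc))

  isInj⇒injective : ∀ {m n} (w : PMap m n) → isInj w ≡ true → ∀ i i′ {c} → at w i ≡ just c → at w i′ ≡ just c → i ≡ i′
  isInj⇒injective (nothing ∷ w) e zero i′ () e2
  isInj⇒injective (nothing ∷ w) e (suc i) zero e1 ()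
  isInj⇒injective (nothing ∷ w) e (suc i) (suc i′) e1 e2 = cong suc (isInj⇒injective w e i i′ e1 e2)
  isInj⇒injective (just d ∷ w) e zero zero e1 e2 = refl
  isInj⇒injective (just d ∷ w) e zero (suc i′) refl e2 = ⊥-elim (notIn-sound w d (∧-trueˡ e) i′ e2)
  isInj⇒injective (just d ∷ w) e (suc i) zero e1 refl = ⊥-elim (notIn-sound w d (∧-trueˡ e) i e1)
  isInj⇒injective (just d ∷ w) e (suc i) (suc i′) e1 e2 = cong suc (isInj⇒injective w (∧-trueʳ {notIn d w} e) i i′ e1 e2)

  pre-at : ∀ {m n} (w : PMap m n) → isInj w ≡ true → ∀ i {c} → at w i ≡ just c → ∃ λ i′ → pre w c ≡ just i′ × toℕ i′ ≡ i
  pre-at w inj i {c} e with pre w c in ep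
  ... | nothing = ⊥-elim (pre-nothing w c ep i e)
  ... | just i′ = i′ , refl , isInj⇒injective w inj (toℕ i′) i (pre-sound w c ep) e

  module Chase {m n : ℕ} (m≤n : m ≤ n) (ψ : PMap m n) (injψ : isInj ψ ≡ true) where
    open Bar m≤n ψ

    toℕ-emb : ∀ i → toℕ (emb i) ≡ toℕ i
    toℕ-emb i = toℕ-inject≤ i m≤n

    barColumn : Fin n → Fin n
    barColumn j = if inImg j then phiStar j else j

    chase-path : ∀ f i → ∃ λ a → iter ψ a (toℕ (chase f i)) ≡ just (toℕ i) ×
                   (∀ a′ → a′ < a → ∃ λ y → iter ψ a′ (toℕ (chase f i)) ≡ just y × InDom ψ y)
    chase-path zero i = 0 , refl , λ _ ()
    chase-path (suc f) i with pre ψ (emb i) in e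
    ... | nothing = 0 , refl , λ _ ()
    ... | just i′ with chase-path f i′
    ...   | a , ea , inter = suc a , path , inter′
      where
      at-i′ : at ψ (toℕ i′) ≡ just (emb i)
      at-i′ = pre-sound ψ (emb i) e
      path : iter ψ (suc a) (toℕ (chase f i′)) ≡ just (toℕ i)
      path = trans (iter-snoc ψ a _ ea at-i′) (cong just (toℕ-emb i))
      inter′ : ∀ a′ → a′ < suc a → ∃ λ y → iter ψ a′ (toℕ (chase f i′)) ≡ just y × InDom ψ y
      inter′ a′ lt with a′ <? a
      ... | yes l = inter a′ l
      ... | no nl with ≤-antisym (≤-pred lt) (≮⇒≥ nl)
      ...   | refl = toℕ i′ , ea , emb i , at-i′

    chase-stops : ∀ f i → pre ψ (emb (chase f i)) ≡ nothing → chase (suc f) i ≡ chase f i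
    chase-stops zero i e with pre ψ (emb i) in e′
    ... | nothing = refl
    ... | just _ = ⊥-elim (just≢nothing e)
    chase-stops (suc f) i e with pre ψ (emb i) in e′
    ... | nothing = refl
    ... | just i′ = chase-stops f i′ e

    chase-stable : ∀ k i → pre ψ (emb (chase k i)) ≡ nothing → ∀ d → chase (k + d) i ≡ chase k i
    chase-stable k i e zero = cong (λ x → chase x i) (+-identityʳ k)
    chase-stable k i e (suc d) = trans (cong (λ x → chase x i) (+-suc k d))
                            (trans (chase-stops (k + d) i (trans (cong (λ x → pre ψ (emb x)) (chase-stable k i e d)) e)) (chase-stable k i e d))

    chase-iter : ∀ f i {x} → pre ψ (emb (chase f i)) ≡ just x → iter ψ f (toℕ (chase f i)) ≡ just (toℕ i)
    chase-iter zero i e = refl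
    chase-iter (suc f) i e with pre ψ (emb i) in e′
    ... | nothing = ⊥-elim (just≢nothing (trans (sym e) e′))
    ... | just i′ = trans (iter-snoc ψ f _ (chase-iter f i′ e) (pre-sound ψ (emb i) e′)) (cong just (toℕ-emb i))

    -- Were the chase still inside the image after n ≥ m steps, two of the rows it visited would
    -- coincide and c ∉ dom ψ would lie on a cycle.
    chase-leaves-image : ∀ (c : Fin n) {i₀} → at ψ (toℕ c) ≡ nothing → pre ψ c ≡ just i₀ →
                         pre ψ (emb (chase n i₀)) ≡ nothing
    chase-leaves-image c {i₀} c∉dom pre-c with pre ψ (emb (chase n i₀)) in e
    ... | nothing = refl
    ... | just _  = ⊥-elim (shorten (b ∸ a) (m<n⇒0<n∸m a<b) (m+[n∸m]≡n (<⇒≤ a<b)))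
      where
      row : ℕ → ℕ
      row k = toℕ (chase k i₀)
      reaches-c : ∀ k → k ≤ n → iter ψ (suc k) (row k) ≡ just (toℕ c)
      reaches-c k le with pre ψ (emb (chase k i₀)) in ek
      ... | just _  = iter-snoc ψ k (row k) (chase-iter k i₀ ek) (pre-sound ψ c pre-c)
      ... | nothing = ⊥-elim (just≢nothing (trans (sym e) (trans (cong (λ z → pre ψ (emb z))
                        (trans (cong (λ z → chase z i₀) (sym (m+[n∸m]≡n le))) (chase-stable k i₀ ek (n ∸ k)))) ek)))
      repeat = collision (row ∘ toℕ) (λ k → toℕ<n (chase (toℕ k) i₀))
      a = toℕ (proj₁ repeat)
      b = toℕ (proj₁ (proj₂ repeat))
      a<b : a < b
      a<b = proj₁ (proj₂ (proj₂ repeat))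
      b≤n : b ≤ n
      b≤n = ≤-trans (≤-pred (toℕ<n (proj₁ (proj₂ repeat)))) m≤n
      shorten : ∀ d → 0 < d → a + d ≡ b → ⊥
      shorten (suc d) _ a+d≡b = just≢nothing (begin
        just (toℕ c)                           ≡⟨ reaches-c b b≤n ⟨
        iter ψ (suc b) (row b)                 ≡⟨ cong (iter ψ (suc b)) (proj₂ (proj₂ (proj₂ repeat))) ⟨
        iter ψ (suc b) (row a)                 ≡⟨ cong (λ k → iter ψ (suc k) (row a)) a+d≡b ⟨
        iter ψ (suc a + suc d) (row a)         ≡⟨ iter-+ ψ (suc a) (suc d) (row a) ⟩
        (iter ψ (suc a) (row a) >>= iter ψ (suc d)) ≡⟨ cong (_>>= iter ψ (suc d)) (reaches-c a (≤-trans (<⇒≤ a<b) b≤n)) ⟩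
        iter ψ (suc d) (toℕ c)                 ≡⟨ iter-∉dom ψ (toℕ c) d c∉dom ⟩
        nothing                                ∎)
        where open ≡-Reasoning

    barColumn-∉image-id : ∀ d → pre ψ d ≡ nothing → barColumn d ≡ d
    barColumn-∉image-id d e rewrite e = refl

    barColumn-∈image : ∀ d {i} → pre ψ d ≡ just i → barColumn d ≡ emb (chase n i)
    barColumn-∈image d e with pre ψ d | e
    ... | just _ | refl = refl

    barColumn-path : ∀ c → ∃ λ a → iter ψ a (toℕ (barColumn c)) ≡ just (toℕ c) ×
               (∀ a′ → a′ < a → ∃ λ y → iter ψ a′ (toℕ (barColumn c)) ≡ just y × InDom ψ y)
    barColumn-path c with pre ψ c in e
    ... | nothing = 0 , refl , λ _ ()
    ... | just i0 rewrite toℕ-emb (chase n i0) with chase-path n i0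
    ...   | a , ea , inter = suc a , iter-snoc ψ a _ ea at-i0 , inter′
      where
      at-i0 : at ψ (toℕ i0) ≡ just c
      at-i0 = pre-sound ψ c e
      inter′ : ∀ a′ → a′ < suc a → ∃ λ y → iter ψ a′ (toℕ (chase n i0)) ≡ just y × InDom ψ y
      inter′ a′ lt with a′ <? a
      ... | yes l = inter a′ l
      ... | no nl with ≤-antisym (≤-pred lt) (≮⇒≥ nl)
      ...   | refl = toℕ i0 , ea , c , at-i0

    barColumn-∉image : ∀ c → at ψ (toℕ c) ≡ nothing → pre ψ (barColumn c) ≡ nothing
    barColumn-∉image c hc with pre ψ c in e
    ... | nothing = e
    ... | just i0 = chase-leaves-image c hc e

    barColumn-injective : ∀ c d → at ψ (toℕ c) ≡ nothing → at ψ (toℕ d) ≡ nothing → barColumn c ≡ barColumn d → c ≡ d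
    barColumn-injective c d hc hd eg with barColumn-path c | barColumn-path d
    ... | a , ea , ia | a′ , ea′ , ia′ with a <? a′
    ...   | yes lt = let (y , ey , (E , aE)) = ia′ a lt in
                     ⊥-elim (just≢nothing (trans (sym aE) (trans (cong (at ψ) (just-injective (trans (sym ey) (trans (cong (λ z → iter ψ a (toℕ z)) (sym eg)) ea)))) hc)))
    ...   | no nlt with a′ <? a
    ...     | yes lt = let (y , ey , (E , aE)) = ia a′ lt in
                     ⊥-elim (just≢nothing (trans (sym aE) (trans (cong (at ψ) (just-injective (trans (sym ey) (trans (cong (λ z → iter ψ a′ (toℕ z)) eg) ea′)))) hd)))
    ...     | no nlt′ with ≤-antisym (≮⇒≥ nlt′) (≮⇒≥ nlt)
    ...       | refl = toℕ-injective (just-injective (trans (sym ea) (trans (cong (λ z → iter ψ a (toℕ z)) eg) ea′)))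

    chase-from : ∀ j (i : Fin m) (c : Fin n) → pre ψ c ≡ nothing → iter ψ j (toℕ c) ≡ just (toℕ i) →
         ∀ f → j ≤ f → toℕ (chase f i) ≡ toℕ c
    chase-from zero i c hp e zero le = sym (just-injective e)
    chase-from zero i c hp e (suc f) le with pre ψ (emb i) in e′
    ... | nothing = sym (just-injective e)
    ... | just x = ⊥-elim (just≢nothing (trans (sym e′) (trans (cong (pre ψ) (toℕ-injective (trans (toℕ-emb i) (sym (just-injective e))))) hp)))
    chase-from (suc j) i c hp e (suc f) (s≤s le) with iter-snoc⁻ ψ j (toℕ c) e
    ... | u , eu , E , aE , tE with pre ψ (emb i) in e′
    ...   | nothing = ⊥-elim (pre-nothing ψ (emb i) e′ u (trans aE (cong just (toℕ-injective (trans tE (sym (toℕ-emb i)))))))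
    ...   | just i′ = chase-from j i′ c hp (trans eu (cong just u≡)) f le
      where
      u≡ : u ≡ toℕ i′
      u≡ = isInj⇒injective ψ injψ u (toℕ i′) (trans aE (cong just (toℕ-injective (trans tE (sym (toℕ-emb i)))))) (pre-sound ψ (emb i) e′)

    iter-cancel : ∀ (c : Fin n) a b {e} → a < b → iter ψ a (toℕ c) ≡ just e → iter ψ b (toℕ c) ≡ just e →
             iter ψ (b ∸ a) (toℕ c) ≡ just (toℕ c)
    iter-cancel c zero b lt ea eb = trans eb (sym ea)
    iter-cancel c (suc a) (suc b) (s≤s lt) ea eb with iter-snoc⁻ ψ a (toℕ c) ea | iter-snoc⁻ ψ b (toℕ c) eb
    ... | u1 , eu1 , E1 , aE1 , tE1 | u2 , eu2 , E2 , aE2 , tE2 with toℕ-injective (trans tE1 (sym tE2))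
    ...   | refl with isInj⇒injective ψ injψ u1 u2 aE1 aE2
    ...     | refl = iter-cancel c a b lt eu1 eu2

    orbit-exits : ∀ (c : Fin n) K → (∃ λ k → k ≤ K × ∃ λ e → iter ψ k (toℕ c) ≡ just e × at ψ e ≡ nothing)
                          ⊎ (∀ k → k ≤ K → ∃ λ e → iter ψ k (toℕ c) ≡ just e × InDom ψ e)
    orbit-exits c zero with at ψ (toℕ c) in ec
    ... | nothing = inj₁ (0 , z≤n , toℕ c , refl , ec)
    ... | just d = inj₂ λ { zero z≤n → toℕ c , refl , d , ec }
    orbit-exits c (suc K) with orbit-exits c K
    ... | inj₁ (k , le , rest) = inj₁ (k , m≤n⇒m≤1+n le , rest)
    ... | inj₂ h with h K ≤-refl
    ...   | eK , iK , E , aE with at ψ (toℕ E) in e2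
    ...     | nothing = inj₁ (suc K , ≤-refl , toℕ E , iter-snoc ψ K (toℕ c) iK aE , e2)
    ...     | just d = inj₂ h′
      where
      h′ : ∀ k → k ≤ suc K → ∃ λ e → iter ψ k (toℕ c) ≡ just e × InDom ψ e
      h′ k le with k ≤? K
      ... | yes l = h k l
      ... | no nl with ≤-antisym le (≰⇒> nl)
      ...   | refl = toℕ E , iter-snoc ψ K (toℕ c) iK aE , d , e2

    barColumn-surjective : ∀ c → pre ψ c ≡ nothing → ∃ λ d → at ψ (toℕ d) ≡ nothing × barColumn d ≡ c
    barColumn-surjective c hp with at ψ (toℕ c) in ec
    ... | nothing = c , ec , barColumn-∉image-id c hp
    ... | just _ with orbit-exits c m
    ...   | inj₂ stays = ⊥-elim (shorten (toℕ b ∸ toℕ a) (m<n⇒0<n∸m a<b) returns)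
      where
      point : Fin (suc m) → ℕ
      point k = proj₁ (stays (toℕ k) (≤-pred (toℕ<n k)))
      point≡ : ∀ k → iter ψ (toℕ k) (toℕ c) ≡ just (point k)
      point≡ k = proj₁ (proj₂ (stays (toℕ k) (≤-pred (toℕ<n k))))
      repeat = collision point (λ k → at-< ψ (point k) (proj₂ (proj₂ (proj₂ (stays (toℕ k) (≤-pred (toℕ<n k)))))))
      a = proj₁ repeat
      b = proj₁ (proj₂ repeat)
      a<b : toℕ a < toℕ b
      a<b = proj₁ (proj₂ (proj₂ repeat))
      returns : iter ψ (toℕ b ∸ toℕ a) (toℕ c) ≡ just (toℕ c)
      returns = iter-cancel c (toℕ a) (toℕ b) a<b (point≡ a) (trans (point≡ b) (cong just (sym (proj₂ (proj₂ (proj₂ repeat))))))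
      shorten : ∀ d → 0 < d → iter ψ d (toℕ c) ≡ just (toℕ c) → ⊥
      shorten (suc d) _ e with iter-snoc⁻ ψ d (toℕ c) e
      ... | u , _ , c′ , at-u , c′≡c = pre-nothing ψ c hp u (trans at-u (cong just (toℕ-injective c′≡c)))
    ...   | inj₁ (zero , le , e , ek , ae) = ⊥-elim (just≢nothing (trans (sym ec) (trans (cong (at ψ) (just-injective ek)) ae)))
    ...   | inj₁ (suc k′ , le , e , ek , ae) with iter-snoc⁻ ψ k′ (toℕ c) ek
    ...     | u , eu , E , aE , tE with pre-at ψ injψ u aE
    ...       | i′ , pE , ti′ = E , trans (cong (at ψ) tE) ae ,
                  toℕ-injective (trans (cong toℕ (barColumn-∈image E pE))
                    (trans (toℕ-emb (chase n i′)) (chase-from k′ i′ c hp (trans eu (cong just (sym ti′))) n (≤-trans (<⇒≤ le) m≤n))))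



module _ where
  open import Data.Nat using (_+_)
  open import Data.Nat.Properties
  open import Relation.Binary.Definitions using (tri<; tri≈; tri>)

  Consecutive : ∀ {n} → ℕ → List (Fin n) → Set
  Consecutive k []       = ⊤
  Consecutive k (x ∷ xs) = toℕ x ≡ k × Consecutive (suc k) xs

  allFin-consecutive : ∀ n → Consecutive 0 (allFin n)
  allFin-consecutive n = tabulate-consecutive 0 id λ _ → refl
    where
    tabulate-consecutive : ∀ {p} k (f : Fin p → Fin n) → (∀ i → toℕ (f i) ≡ k + toℕ i) → Consecutive k (tabulate f)
    tabulate-consecutive {zero}  k f h = tt
    tabulate-consecutive {suc p} k f h = trans (h Fin.zero) (+-identityʳ k) ,
      tabulate-consecutive (suc k) (f ∘ Fin.suc) (λ i → trans (h (Fin.suc i)) (+-suc k (toℕ i)))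

  module _ {n : ℕ} (P : Fin n → Bool) where

    lookup-filter-≥ : ∀ k xs → Consecutive k xs → ∀ pos → k + toℕ pos ≤ toℕ (lookup (filterᵇ P xs) pos)
    lookup-filter-≥ k (x ∷ xs) (x≡k , rest) pos with P x
    ... | false = ≤-trans (+-monoˡ-≤ (toℕ pos) (n≤1+n k)) (lookup-filter-≥ (suc k) xs rest pos)
    lookup-filter-≥ k (x ∷ xs) (x≡k , rest) Fin.zero      | true = ≤-reflexive (trans (+-identityʳ k) (sym x≡k))
    lookup-filter-≥ k (x ∷ xs) (x≡k , rest) (Fin.suc pos) | true =
      ≤-trans (≤-reflexive (+-suc k (toℕ pos))) (lookup-filter-≥ (suc k) xs rest pos)

    lookup-filter-prefix : ∀ r k xs → Consecutive k xs → (∀ c → toℕ c < r → P c ≡ true) →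
                           ∀ pos → k + toℕ pos < r → toℕ (lookup (filterᵇ P xs) pos) ≡ k + toℕ pos
    lookup-filter-prefix r k (x ∷ xs) (x≡k , rest) h pos lt with P x in ep
    ... | false = ⊥-elim (true≢false (trans (sym (h x (subst (_< r) (sym x≡k) (≤-<-trans (m≤m+n k (toℕ pos)) lt)))) ep))
    lookup-filter-prefix r k (x ∷ xs) (x≡k , rest) h Fin.zero      lt | true = trans x≡k (sym (+-identityʳ k))
    lookup-filter-prefix r k (x ∷ xs) (x≡k , rest) h (Fin.suc pos) lt | true =
      trans (lookup-filter-prefix r (suc k) xs rest h pos (subst (_< r) (+-suc k (toℕ pos)) lt)) (sym (+-suc k (toℕ pos)))

    lookup-filter-satisfies : ∀ xs pos → P (lookup (filterᵇ P xs) pos) ≡ true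
    lookup-filter-satisfies (x ∷ xs) pos with P x in ep
    lookup-filter-satisfies (x ∷ xs) Fin.zero      | true = ep
    lookup-filter-satisfies (x ∷ xs) (Fin.suc pos) | true = lookup-filter-satisfies xs pos
    lookup-filter-satisfies (x ∷ xs) pos           | false = lookup-filter-satisfies xs pos

    lookup-filter-strictMono : ∀ k xs → Consecutive k xs → ∀ i j → toℕ i < toℕ j →
                               toℕ (lookup (filterᵇ P xs) i) < toℕ (lookup (filterᵇ P xs) j)
    lookup-filter-strictMono k (x ∷ xs) (x≡k , rest) i j lt with P x
    lookup-filter-strictMono k (x ∷ xs) (x≡k , rest) Fin.zero (Fin.suc j) lt | true =
      ≤-trans (s≤s (≤-reflexive x≡k)) (≤-trans (m≤m+n (suc k) (toℕ j)) (lookup-filter-≥ (suc k) xs rest j))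
    lookup-filter-strictMono k (x ∷ xs) (x≡k , rest) (Fin.suc i) (Fin.suc j) (s≤s lt) | true =
      lookup-filter-strictMono (suc k) xs rest i j lt
    lookup-filter-strictMono k (x ∷ xs) (x≡k , rest) i j lt | false = lookup-filter-strictMono (suc k) xs rest i j lt

    lookup-filter-injective : ∀ k xs → Consecutive k xs → ∀ i j →
                              lookup (filterᵇ P xs) i ≡ lookup (filterᵇ P xs) j → i ≡ j
    lookup-filter-injective k xs cons i j e with <-cmp (toℕ i) (toℕ j)
    ... | tri< lt _ _ = ⊥-elim (<-irrefl (cong toℕ e) (lookup-filter-strictMono k xs cons i j lt))
    ... | tri≈ _ eq _ = toℕ-injective eq
    ... | tri> _ _ gt = ⊥-elim (<-irrefl (cong toℕ (sym e)) (lookup-filter-strictMono k xs cons j i gt))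

  lookup-map : ∀ {A B : Set} (g : A → B) (xs : List A) pos →
               ∃ λ pos′ → toℕ pos′ ≡ toℕ pos × lookup (map g xs) pos ≡ g (lookup xs pos′)
  lookup-map g (x ∷ xs) Fin.zero      = Fin.zero , refl , refl
  lookup-map g (x ∷ xs) (Fin.suc pos) with lookup-map g xs pos
  ... | pos′ , same-index , e = Fin.suc pos′ , cong suc same-index , e

module _ where
  open import Data.Nat using (_+_)
  open import Data.Nat.Properties

  nothings : ∀ r {q} → PMap r q
  nothings r = Vec.replicate r nothing

  nothings-++ : ∀ r s {q} → nothings r Vec.++ nothings s ≡ nothings (r + s) {q}
  nothings-++ zero    s = refl
  nothings-++ (suc r) s = cong (nothing ∷_) (nothings-++ r s)

  mapCols : ∀ {r p n} → (Fin p → Fin n) → PMap r p → PMap r n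
  mapCols f = Vec.map (Maybe.map f)

  at-nothings : ∀ r {q} j → at (nothings r {q}) j ≡ nothing
  at-nothings zero    j       = refl
  at-nothings (suc r) zero    = refl
  at-nothings (suc r) (suc j) = at-nothings r j

  at-mapCols : ∀ {r p n} (f : Fin p → Fin n) (τ : PMap r p) j → at (mapCols f τ) j ≡ Maybe.map f (at τ j)
  at-mapCols f []      j       = refl
  at-mapCols f (x ∷ τ) zero    = refl
  at-mapCols f (x ∷ τ) (suc j) = at-mapCols f τ j

  at-++ˡ : ∀ {r s q} (t : PMap r q) (b : PMap s q) j → j < r → at (t Vec.++ b) j ≡ at t j
  at-++ˡ (x ∷ t) b zero    lt       = refl
  at-++ˡ (x ∷ t) b (suc j) (s≤s lt) = at-++ˡ t b j lt

  at-++ʳ : ∀ {r s q} (t : PMap r q) (b : PMap s q) j → r ≤ j → at (t Vec.++ b) j ≡ at b (j ∸ r)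
  at-++ʳ []      b j       le       = refl
  at-++ʳ (x ∷ t) b (suc j) (s≤s le) = at-++ʳ t b j le

  notIn-++ : ∀ {r s q} (c : Fin q) (t : PMap r q) (b : PMap s q) → notIn c (t Vec.++ b) ≡ (notIn c t ∧ notIn c b)
  notIn-++ c []            b = refl
  notIn-++ c (nothing ∷ t) b = notIn-++ c t b
  notIn-++ c (just d ∷ t)  b = trans (cong (not (toℕ c ≡ᵇ toℕ d) ∧_) (notIn-++ c t b)) (sym (∧-assoc (not (toℕ c ≡ᵇ toℕ d)) _ _))

  notIn-nothings-++ : ∀ r {s q} (c : Fin q) (b : PMap s q) → notIn c (nothings r Vec.++ b) ≡ notIn c b
  notIn-nothings-++ zero    c b = refl
  notIn-nothings-++ (suc r) c b = notIn-nothings-++ r c b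

  isInj-++ʳ : ∀ {r s q} (t : PMap r q) (b : PMap s q) → isInj (t Vec.++ b) ≡ true → isInj b ≡ true
  isInj-++ʳ []            b e = e
  isInj-++ʳ (nothing ∷ t) b e = isInj-++ʳ t b e
  isInj-++ʳ (just c ∷ t)  b e = isInj-++ʳ t b (∧-trueʳ {notIn c (t Vec.++ b)} e)

  isInj-nothings-++ : ∀ r {s q} (b : PMap s q) → isInj (nothings r Vec.++ b) ≡ isInj b
  isInj-nothings-++ zero    b = refl
  isInj-nothings-++ (suc r) b = isInj-nothings-++ r b

  domSize-++ : ∀ {r s q} (t : PMap r q) (b : PMap s q) → domSize (t Vec.++ b) ≡ domSize t + domSize b
  domSize-++ []            b = refl
  domSize-++ (nothing ∷ t) b = domSize-++ t b
  domSize-++ (just _ ∷ t)  b = cong suc (domSize-++ t b)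

  domSize-mapCols : ∀ {r p n} (f : Fin p → Fin n) (τ : PMap r p) → domSize (mapCols f τ) ≡ domSize τ
  domSize-mapCols f []            = refl
  domSize-mapCols f (nothing ∷ τ) = domSize-mapCols f τ
  domSize-mapCols f (just _ ∷ τ)  = cong suc (domSize-mapCols f τ)

  domSize-nothings-++ : ∀ r {s q} (b : PMap s q) → domSize (nothings r Vec.++ b) ≡ domSize b
  domSize-nothings-++ zero    b = refl
  domSize-nothings-++ (suc r) b = domSize-nothings-++ r b

  domSize≡0 : ∀ {r q} (t : PMap r q) → (∀ i → i < r → at t i ≡ nothing) → domSize t ≡ 0
  domSize≡0 []            h = refl
  domSize≡0 (nothing ∷ t) h = domSize≡0 t (λ i lt → h (suc i) (s≤s lt))
  domSize≡0 (just c ∷ t)  h with h 0 (s≤s z≤n)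
  ... | ()

  domSize-≤ : ∀ {m q} (v : PMap m q) → domSize v ≤ m
  domSize-≤ []            = z≤n
  domSize-≤ (nothing ∷ v) = m≤n⇒m≤1+n (domSize-≤ v)
  domSize-≤ (just _ ∷ v)  = s≤s (domSize-≤ v)

  supportAbove-++ : ∀ {r s q} (t : PMap r q) (b : PMap s q) → (domSize t ≡ᵇ 0) ≡ false →
                    supportAbove r (t Vec.++ b) ≡ false
  supportAbove-++ {r} t b e with allL (λ i → not (inDom (t Vec.++ b) i)) (upTo r) in top-empty
  ... | false = refl
  ... | true  = ⊥-elim (true≢false (trans (sym (≡ᵇ-complete _ _ (domSize≡0 t λ i lt →
                  trans (sym (at-++ˡ t b i lt)) (not-is-just _ (allL-sound _ id r top-empty i lt))))) e))

  supportAbove-nothings-++ : ∀ {r s q} (b : PMap s q) → supportAbove r (nothings r Vec.++ b) ≡ not (domSize b ≡ᵇ 0)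
  supportAbove-nothings-++ {r} b =
    cong₂ _∧_ (allL-complete _ id r (λ i lt → cong (not ∘ is-just) (trans (at-++ˡ (nothings r) b i lt) (at-nothings r i))))
              (cong (λ d → not (d ≡ᵇ 0)) (domSize-nothings-++ r b))

  isInj-nothings : ∀ m {q} → isInj (nothings m {q}) ≡ true
  isInj-nothings zero    = refl
  isInj-nothings (suc m) = isInj-nothings m

  domSize-nothings : ∀ m {q} → domSize (nothings m {q}) ≡ 0
  domSize-nothings zero    = refl
  domSize-nothings (suc m) = domSize-nothings m

  cycles-nothings : ∀ m {q} → cycles (nothings m {q}) ≡ 0
  cycles-nothings m {q} = count-none _ m λ j _ → ∧-false λ cyc _ →
    let (P , _ , eP) = onCycle-sound (nothings m) j cyc in just≢nothing (trans (sym eP) (iter-∉dom (nothings m {q}) j P (at-nothings m j)))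

  filterᵇ-all : ∀ {A : Set} (p : A → Bool) xs → (∀ a → p a ≡ true) → filterᵇ p xs ≡ xs
  filterᵇ-all p []       h = refl
  filterᵇ-all p (x ∷ xs) h with p x | h x
  ... | true | refl = cong (x ∷_) (filterᵇ-all p xs h)

  phiBar-nothings : ∀ {m n} (m≤n : m ≤ n) → phiBar m≤n (nothings m) ≡ allFin n
  phiBar-nothings {m} {n} m≤n =
    trans (Listₚ.map-cong fixed (filterᵇ _ (allFin n))) (trans (Listₚ.map-id _) (filterᵇ-all _ (allFin n) free))
    where
    open Bar m≤n (nothings m)
    fixed : ∀ j → (if inImg j then phiStar j else j) ≡ j
    fixed j rewrite pre-∉image (nothings m) j (λ i e → just≢nothing (trans (sym e) (at-nothings m i))) = refl
    free : ∀ (j : Fin n) → not (inDom (nothings m) (toℕ j)) ≡ true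
    free j = cong (not ∘ is-just) (at-nothings m (toℕ j))

  notIn-mapCols : ∀ {r p n} (f : Fin p → Fin n) → (∀ i j → f i ≡ f j → i ≡ j) →
                  ∀ i (τ : PMap r p) → notIn (f i) (mapCols f τ) ≡ notIn i τ
  notIn-mapCols f f-inj i []            = refl
  notIn-mapCols f f-inj i (nothing ∷ τ) = notIn-mapCols f f-inj i τ
  notIn-mapCols f f-inj i (just j ∷ τ)  = cong₂ (λ a b → not a ∧ b) same (notIn-mapCols f f-inj i τ)
    where
    same : (toℕ (f i) ≡ᵇ toℕ (f j)) ≡ (toℕ i ≡ᵇ toℕ j)
    same = Bool-ext (λ e → ≡ᵇ-complete _ _ (cong toℕ (f-inj i j (toℕ-injective (≡ᵇ-sound _ _ e)))))
                    (λ e → ≡ᵇ-complete _ _ (cong (toℕ ∘ f) (toℕ-injective (≡ᵇ-sound _ _ e))))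

module _ where
  open import Data.Nat using (_+_)
  open import Data.Nat.Properties

  -- ψ is φ restricted to the bottom rows; the free columns (outside dom ψ), relabelled by
  -- barColumn, form the list φ̄(N_n), whose pos-th entry is `column pos`.
  module BottomPart {r s n : ℕ} (m≤n : r + s ≤ n) (b : PMap s n) (injb : isInj b ≡ true) where

    ψ : PMap (r + s) n
    ψ = nothings r Vec.++ b

    injψ : isInj ψ ≡ true
    injψ = trans (isInj-nothings-++ r b) injb

    open Bar m≤n ψ using (barN)
    open Chase m≤n ψ injψ public

    isFree : Fin n → Bool
    isFree j = not (inDom ψ (toℕ j))

    freeColumns : List (Fin n)
    freeColumns = filterᵇ isFree (allFin n)

    width : ℕ
    width = length barN

    column : Fin width → Fin n
    column = lookup barN

    ψ-top : ∀ j → j < r → at ψ j ≡ nothing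
    ψ-top j lt = trans (at-++ˡ (nothings r) b j lt) (at-nothings r j)

    dom-bottom : ∀ y → InDom ψ y → r ≤ y
    dom-bottom y (c , e) with y <? r
    ... | yes lt  = ⊥-elim (just≢nothing (trans (sym e) (ψ-top y lt)))
    ... | no nlt = ≮⇒≥ nlt

    isFree-top : ∀ c → toℕ c < r → isFree c ≡ true
    isFree-top c lt = cong (not ∘ is-just) (ψ-top (toℕ c) lt)

    freeColumn : ∀ pos → ∃ λ pos′ → toℕ pos′ ≡ toℕ pos × column pos ≡ barColumn (lookup freeColumns pos′)
    freeColumn = lookup-map barColumn freeColumns

    column-injective : ∀ i j → column i ≡ column j → i ≡ j
    column-injective i j e with freeColumn i | freeColumn j
    ... | i′ , i′≡i , ci | j′ , j′≡j , cj = toℕ-injective (trans (sym i′≡i) (trans (cong toℕ same-free) j′≡j))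
      where
      same-free : i′ ≡ j′
      same-free = lookup-filter-injective isFree 0 (allFin n) (allFin-consecutive n) i′ j′
        (barColumn-injective _ _ (not-is-just _ (lookup-filter-satisfies isFree (allFin n) i′))
          (not-is-just _ (lookup-filter-satisfies isFree (allFin n) j′)) (trans (sym ci) (trans e cj)))

    returnPath : ∀ pos → ∃ λ cn → (toℕ pos < r → cn ≡ toℕ pos) × (r ≤ toℕ pos → r ≤ cn) ×
                                  at ψ cn ≡ nothing × PathAbove ψ r (toℕ (column pos)) cn
    returnPath pos with freeColumn pos
    ... | pos′ , pos′≡pos , col with barColumn-path (lookup freeColumns pos′)
    ...   | a , path , inDom =
            toℕ c ,
            (λ lt → trans (lookup-filter-prefix isFree r 0 (allFin n) (allFin-consecutive n) isFree-top pos′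
                             (subst (_< r) (sym pos′≡pos) lt)) pos′≡pos) ,
            (λ le → ≤-trans le (≤-trans (≤-reflexive (sym pos′≡pos))
                             (lookup-filter-≥ isFree 0 (allFin n) (allFin-consecutive n) pos′))) ,
            not-is-just (at ψ (toℕ c)) (lookup-filter-satisfies isFree (allFin n) pos′) ,
            a , subst (λ z → iter ψ a (toℕ z) ≡ just (toℕ c)) (sym col) path ,
            λ a′ lt → let (y , ey , y∈dom) = inDom a′ lt in
                      y , subst (λ z → iter ψ a′ (toℕ z) ≡ just y) (sym col) ey , dom-bottom y y∈dom
      where
      c = lookup freeColumns pos′

    cycles-++ : ∀ (τ : PMap r width) → cycles (mapCols column τ Vec.++ b) ≡ cycles ψ + cycles τ
    cycles-++ τ = GluedCycles.cycles-glued (mapCols column τ Vec.++ b) ψ τ column (m≤m+n r s)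
      (λ j lt → trans (at-++ˡ (mapCols column τ) b j lt) (at-mapCols column τ j))
      (λ j le → trans (at-++ʳ (mapCols column τ) b j le) (sym (at-++ʳ (nothings r) b j le)))
      ψ-top returnPath

    -- barColumn maps the free columns bijectively onto the columns outside the image of b.
    hits : Fin n → Fin n → Bool
    hits c d = isFree d ∧ (toℕ (barColumn d) ≡ᵇ toℕ c)

    hits-unique : ∀ c → notIn c b ≡ true → ∃ λ d₀ → ∀ d → hits c d ≡ (toℕ d₀ ≡ᵇ toℕ d)
    hits-unique c c∉b = d₀ , λ d → Bool-ext
        (λ h → ≡ᵇ-complete _ _ (cong toℕ (barColumn-injective d₀ d d₀-free (not-is-just _ (∧-trueˡ h))
                 (trans d₀↦c (sym (toℕ-injective (≡ᵇ-sound _ _ (∧-trueʳ {isFree d} h))))))))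
        (λ h → subst (λ w → hits c w ≡ true) (toℕ-injective (≡ᵇ-sound _ _ h))
                 (∧-true (cong (not ∘ is-just) d₀-free) (≡ᵇ-complete _ _ (cong toℕ d₀↦c))))
      where
      c∉image : pre ψ c ≡ nothing
      c∉image = pre-∉image ψ c (notIn-sound ψ c (trans (notIn-nothings-++ r c b) c∉b))
      preimage = barColumn-surjective c c∉image
      d₀ = proj₁ preimage
      d₀-free : at ψ (toℕ d₀) ≡ nothing
      d₀-free = proj₁ (proj₂ preimage)
      d₀↦c : barColumn d₀ ≡ c
      d₀↦c = proj₂ (proj₂ preimage)

    hits-none : ∀ c → notIn c b ≡ false → ∀ d → hits c d ≡ false
    hits-none c c∈b d = ∧-false λ d-free d↦c →
      let c∉image = subst (λ w → pre ψ w ≡ nothing) (toℕ-injective (≡ᵇ-sound _ _ d↦c))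
                          (barColumn-∉image d (not-is-just _ d-free))
      in true≢false (trans (sym (trans (sym (notIn-nothings-++ r c b))
                                       (notIn-complete ψ c (pre-nothing ψ c c∉image)))) c∈b)

module _ {c ℓ} (R : CommutativeRing c ℓ) where
  open CommutativeRing R renaming (refl to ≈-refl; sym to ≈-sym; trans to ≈-trans)
  open Rook R
  open import Relation.Binary.Reasoning.Setoid (CommutativeRing.setoid R)

  Σ : ∀ {A : Set} → List A → (A → Carrier) → Carrier
  Σ xs F = sumL (map F xs)

  [_]_ : Bool → Carrier → Carrier
  [ b ] x = if b then x else 0#
  infixr 6 [_]_

  ≡⇒≈ : ∀ {a b} → a ≡ b → a ≈ b
  ≡⇒≈ refl = ≈-refl

  Σ-cong : ∀ {A : Set} (xs : List A) {F G : A → Carrier} → (∀ a → F a ≈ G a) → Σ xs F ≈ Σ xs G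
  Σ-cong []       h = ≈-refl
  Σ-cong (x ∷ xs) h = +-cong (h x) (Σ-cong xs h)

  Σ-cong-≡ : ∀ {A : Set} (xs : List A) {F G : A → Carrier} → (∀ a → F a ≡ G a) → Σ xs F ≡ Σ xs G
  Σ-cong-≡ xs h = cong sumL (Listₚ.map-cong h xs)

  Σ-++ : ∀ {A : Set} (xs ys : List A) F → Σ (xs ++ ys) F ≈ Σ xs F + Σ ys F
  Σ-++ []       ys F = ≈-sym (+-identityˡ _)
  Σ-++ (x ∷ xs) ys F = ≈-trans (+-congˡ (Σ-++ xs ys F)) (≈-sym (+-assoc _ _ _))

  Σ-map : ∀ {A B : Set} (g : A → B) (xs : List A) F → Σ (map g xs) F ≡ Σ xs (F ∘ g)
  Σ-map g xs F = cong sumL (sym (Listₚ.map-∘ xs))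

  Σ-concatMap : ∀ {A B : Set} (g : A → List B) (xs : List A) F → Σ (concatMap g xs) F ≈ Σ xs (λ a → Σ (g a) F)
  Σ-concatMap g []       F = ≈-refl
  Σ-concatMap g (x ∷ xs) F = ≈-trans (Σ-++ (g x) (concatMap g xs) F) (+-congˡ (Σ-concatMap g xs F))

  Σ-filter : ∀ {A : Set} (p : A → Bool) (xs : List A) F → Σ (filterᵇ p xs) F ≈ Σ xs (λ a → [ p a ] F a)
  Σ-filter p []       F = ≈-refl
  Σ-filter p (x ∷ xs) F with p x
  ... | true  = +-congˡ (Σ-filter p xs F)
  ... | false = ≈-trans (Σ-filter p xs F) (≈-sym (+-identityˡ _))

  Σ-0 : ∀ {A : Set} (xs : List A) → Σ xs (λ _ → 0#) ≈ 0#
  Σ-0 []       = ≈-refl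
  Σ-0 (x ∷ xs) = ≈-trans (+-identityˡ _) (Σ-0 xs)

  Σ-+ : ∀ {A : Set} (xs : List A) F G → Σ xs (λ a → F a + G a) ≈ Σ xs F + Σ xs G
  Σ-+ []       F G = ≈-sym (+-identityˡ 0#)
  Σ-+ (x ∷ xs) F G = begin
    (F x + G x) + Σ xs (λ a → F a + G a)  ≈⟨ +-congˡ (Σ-+ xs F G) ⟩
    (F x + G x) + (Σ xs F + Σ xs G)       ≈⟨ +-assoc _ _ _ ⟩
    F x + (G x + (Σ xs F + Σ xs G))       ≈⟨ +-congˡ (≈-sym (+-assoc _ _ _)) ⟩
    F x + ((G x + Σ xs F) + Σ xs G)       ≈⟨ +-congˡ (+-congʳ (+-comm _ _)) ⟩
    F x + ((Σ xs F + G x) + Σ xs G)       ≈⟨ +-congˡ (+-assoc _ _ _) ⟩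
    F x + (Σ xs F + (G x + Σ xs G))       ≈⟨ +-assoc _ _ _ ⟨
    (F x + Σ xs F) + (G x + Σ xs G)       ∎

  Σ-*ˡ : ∀ {A : Set} (xs : List A) a F → a * Σ xs F ≈ Σ xs (λ y → a * F y)
  Σ-*ˡ []       a F = zeroʳ a
  Σ-*ˡ (x ∷ xs) a F = ≈-trans (distribˡ a _ _) (+-congˡ (Σ-*ˡ xs a F))

  Σ-*ʳ : ∀ {A : Set} (xs : List A) a F → Σ xs F * a ≈ Σ xs (λ y → F y * a)
  Σ-*ʳ []       a F = zeroˡ a
  Σ-*ʳ (x ∷ xs) a F = ≈-trans (distribʳ a _ _) (+-congˡ (Σ-*ʳ xs a F))

  Σ-swap : ∀ {A B : Set} (xs : List A) (ys : List B) (F : A → B → Carrier) →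
           Σ xs (λ a → Σ ys (F a)) ≈ Σ ys (λ b → Σ xs (λ a → F a b))
  Σ-swap []       ys F = ≈-sym (Σ-0 ys)
  Σ-swap (x ∷ xs) ys F = ≈-trans (+-congˡ (Σ-swap xs ys F)) (≈-sym (Σ-+ ys (F x) (λ b → Σ xs (λ a → F a b))))

  [-]-cong : ∀ b {x y} → x ≈ y → [ b ] x ≈ [ b ] y
  [-]-cong true  e = e
  [-]-cong false e = ≈-refl

  [-]-∧ : ∀ a b x → [ a ] [ b ] x ≡ [ a ∧ b ] x
  [-]-∧ true  b x = refl
  [-]-∧ false b x = refl

  [-]-*ˡ : ∀ b a x → a * ([ b ] x) ≈ [ b ] (a * x)
  [-]-*ˡ true  a x = ≈-refl
  [-]-*ˡ false a x = zeroʳ a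

  [-]-*ʳ : ∀ b a x → ([ b ] x) * a ≈ [ b ] (x * a)
  [-]-*ʳ true  a x = ≈-refl
  [-]-*ʳ false a x = zeroˡ a

  [-]-0 : ∀ b → [ b ] 0# ≈ 0#
  [-]-0 true  = ≈-refl
  [-]-0 false = ≈-refl

  Σ-[-] : ∀ {A : Set} (xs : List A) b F → Σ xs (λ a → [ b ] F a) ≈ [ b ] Σ xs F
  Σ-[-] xs true  F = ≈-refl
  Σ-[-] xs false F = Σ-0 xs

  [-]-split : ∀ a e x → [ a ] x ≈ ([ a ∧ not e ] x) + ([ a ∧ e ] x)
  [-]-split true  true  x = ≈-sym (+-identityˡ x)
  [-]-split true  false x = ≈-sym (+-identityʳ x)
  [-]-split false e     x = ≈-sym (+-identityˡ 0#)

  Σ-allFin-δ : ∀ n (y : Fin n) (H : Fin n → Carrier) → Σ (allFin n) (λ d → [ toℕ y ≡ᵇ toℕ d ] H d) ≈ H y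
  Σ-allFin-δ (suc n) y H = begin
      Σ (allFin (suc n)) (λ d → [ toℕ y ≡ᵇ toℕ d ] H d)
    ≡⟨ cong (λ l → ([ toℕ y ≡ᵇ 0 ] H Fin.zero) + sumL l)
         (trans (Listₚ.map-tabulate Fin.suc (λ d → [ toℕ y ≡ᵇ toℕ d ] H d))
                (sym (Listₚ.map-tabulate id (λ d → [ toℕ y ≡ᵇ toℕ (Fin.suc d) ] H (Fin.suc d))))) ⟩
      ([ toℕ y ≡ᵇ 0 ] H Fin.zero) + Σ (allFin n) (λ d → [ toℕ y ≡ᵇ suc (toℕ d) ] H (Fin.suc d))
    ≈⟨ split y ⟩
      H y ∎
    where
    split : ∀ y → ([ toℕ y ≡ᵇ 0 ] H Fin.zero) + Σ (allFin n) (λ d → [ toℕ y ≡ᵇ suc (toℕ d) ] H (Fin.suc d)) ≈ H y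
    split Fin.zero    = ≈-trans (+-congˡ (Σ-0 (allFin n))) (+-identityʳ _)
    split (Fin.suc y) = ≈-trans (+-identityˡ _) (Σ-allFin-δ n y (H ∘ Fin.suc))

  Σ-upTo-δ : ∀ N d (H : ℕ → Carrier) → d < N → Σ (upTo N) (λ l → [ d ≡ᵇ l ] H l) ≈ H d
  Σ-upTo-δ N d H lt = begin
      Σ (upTo N) (λ l → [ d ≡ᵇ l ] H l)
    ≡⟨ cong (λ l → Σ l (λ l → [ d ≡ᵇ l ] H l)) (trans (upTo-tabulate id N) (sym (Listₚ.map-tabulate id toℕ))) ⟩
      Σ (map toℕ (allFin N)) (λ l → [ d ≡ᵇ l ] H l)
    ≡⟨ Σ-map toℕ (allFin N) _ ⟩
      Σ (allFin N) (λ i → [ d ≡ᵇ toℕ i ] H (toℕ i))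
    ≡⟨ cong (λ e → Σ (allFin N) (λ i → [ e ≡ᵇ toℕ i ] H (toℕ i))) (sym (toℕ-fromℕ< lt)) ⟩
      Σ (allFin N) (λ i → [ toℕ (Fin.fromℕ< lt) ≡ᵇ toℕ i ] H (toℕ i))
    ≈⟨ Σ-allFin-δ N (Fin.fromℕ< lt) (H ∘ toℕ) ⟩
      H (toℕ (Fin.fromℕ< lt))
    ≡⟨ cong H (toℕ-fromℕ< lt) ⟩
      H d ∎
    where
    upTo-tabulate : ∀ (f : ℕ → ℕ) N → applyUpTo f N ≡ tabulate {n = N} (f ∘ toℕ)
    upTo-tabulate f zero    = refl
    upTo-tabulate f (suc N) = cong (f 0 ∷_) (upTo-tabulate (f ∘ suc) N)

  weight : ∀ {m q} → Carrier → Carrier → (Fin m → Fin q → Carrier) → PMap m q → Carrier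
  weight x z B v = pow z (cycles v) * prodA B v * pow x (domSize v)

  rookPoly-as-sum : ∀ {m q} x z (B : Fin m → Fin q → Carrier) → rookPoly x z B ≈ Σ (Inj m q) (weight x z B)
  rookPoly-as-sum {m} {q} x z B = begin
      rookPoly x z B
    ≈⟨ Σ-cong (upTo (suc m)) coefficient ⟩
      Σ (upTo (suc m)) (λ l → Σ (Inj m q) (λ v → [ domSize v ≡ᵇ l ] (zp v * pow x l)))
    ≈⟨ Σ-swap (upTo (suc m)) (Inj m q) (λ l v → [ domSize v ≡ᵇ l ] (zp v * pow x l)) ⟩
      Σ (Inj m q) (λ v → Σ (upTo (suc m)) (λ l → [ domSize v ≡ᵇ l ] (zp v * pow x l)))
    ≈⟨ Σ-cong (Inj m q) (λ v → Σ-upTo-δ (suc m) (domSize v) (λ l → zp v * pow x l) (s≤s (domSize-≤ v))) ⟩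
      Σ (Inj m q) (weight x z B) ∎
    where
    zp : PMap m q → Carrier
    zp v = pow z (cycles v) * prodA B v
    coefficient : ∀ l → rookCoeff z B l * pow x l ≈ Σ (Inj m q) (λ v → [ domSize v ≡ᵇ l ] (zp v * pow x l))
    coefficient l = begin
        rookCoeff z B l * pow x l
      ≈⟨ *-congʳ (Σ-filter (λ v → domSize v ≡ᵇ l) (Inj m q) zp) ⟩
        Σ (Inj m q) (λ v → [ domSize v ≡ᵇ l ] zp v) * pow x l
      ≈⟨ Σ-*ʳ (Inj m q) (pow x l) _ ⟩
        Σ (Inj m q) (λ v → ([ domSize v ≡ᵇ l ] zp v) * pow x l)
      ≈⟨ Σ-cong (Inj m q) (λ v → [-]-*ʳ (domSize v ≡ᵇ l) (pow x l) (zp v)) ⟩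
        Σ (Inj m q) (λ v → [ domSize v ≡ᵇ l ] (zp v * pow x l)) ∎

  Σ-allPMaps-suc : ∀ m q (F : PMap (suc m) q → Carrier) →
    Σ (allPMaps (suc m) q) F ≈ Σ (allPMaps m q) (λ v → F (nothing ∷ v) + Σ (allFin q) (λ c → F (just c ∷ v)))
  Σ-allPMaps-suc m q F = ≈-trans (Σ-concatMap _ (allPMaps m q) F) (Σ-cong (allPMaps m q) λ v →
    +-congˡ (≡⇒≈ (trans (Σ-map (_∷ v) (map just (allFin q)) F) (Σ-map just (allFin q) _))))

  Σ-allPMaps-++ : ∀ r s q (F : PMap (r ℕ.+ s) q → Carrier) →
    Σ (allPMaps (r ℕ.+ s) q) F ≈ Σ (allPMaps s q) (λ b → Σ (allPMaps r q) (λ t → F (t Vec.++ b)))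
  Σ-allPMaps-++ zero    s q F = Σ-cong (allPMaps s q) (λ b → ≈-sym (+-identityʳ _))
  Σ-allPMaps-++ (suc r) s q F = begin
      Σ (allPMaps (suc (r ℕ.+ s)) q) F
    ≈⟨ Σ-allPMaps-suc (r ℕ.+ s) q F ⟩
      Σ (allPMaps (r ℕ.+ s) q) (λ v → F (nothing ∷ v) + Σ (allFin q) (λ c → F (just c ∷ v)))
    ≈⟨ Σ-allPMaps-++ r s q _ ⟩
      Σ (allPMaps s q) (λ b → Σ (allPMaps r q) (λ t → F (nothing ∷ (t Vec.++ b)) + Σ (allFin q) (λ c → F (just c ∷ (t Vec.++ b)))))
    ≈⟨ Σ-cong (allPMaps s q) (λ b → ≈-sym (Σ-allPMaps-suc r q (λ t → F (t Vec.++ b)))) ⟩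
      Σ (allPMaps s q) (λ b → Σ (allPMaps (suc r) q) (λ t → F (t Vec.++ b))) ∎

  Σ-allPMaps-domSize≡0 : ∀ s q (H : PMap s q → Carrier) → Σ (allPMaps s q) (λ b → [ domSize b ≡ᵇ 0 ] H b) ≈ H (nothings s)
  Σ-allPMaps-domSize≡0 zero    q H = +-identityʳ _
  Σ-allPMaps-domSize≡0 (suc s) q H = begin
      Σ (allPMaps (suc s) q) (λ b → [ domSize b ≡ᵇ 0 ] H b)
    ≈⟨ Σ-allPMaps-suc s q _ ⟩
      Σ (allPMaps s q) (λ v → ([ domSize v ≡ᵇ 0 ] H (nothing ∷ v)) + Σ (allFin q) (λ c → 0#))
    ≈⟨ Σ-cong (allPMaps s q) (λ v → ≈-trans (+-congˡ (Σ-0 (allFin q))) (+-identityʳ _)) ⟩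
      Σ (allPMaps s q) (λ v → [ domSize v ≡ᵇ 0 ] H (nothing ∷ v))
    ≈⟨ Σ-allPMaps-domSize≡0 s q (λ v → H (nothing ∷ v)) ⟩
      H (nothings (suc s)) ∎

  -- If f enumerates the columns outside the image of b, the injective extensions t ++ b of b
  -- correspond to the injective τ via t = mapCols f τ.
  Σ-injective-extensions : ∀ {s n p} (b : PMap s n) → isInj b ≡ true →
    (f : Fin p → Fin n) → (∀ i j → f i ≡ f j → i ≡ j) →
    (∀ (H : Fin n → Carrier) → Σ (allFin n) (λ c → [ notIn c b ] H c) ≈ Σ (allFin p) (H ∘ f)) →
    ∀ r (F : PMap r n → Carrier) →
    Σ (allPMaps r n) (λ t → [ isInj (t Vec.++ b) ] F t) ≈ Σ (allPMaps r p) (λ τ → [ isInj τ ] F (mapCols f τ))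
  Σ-injective-extensions b injb f f-inj enumerates zero F = +-congʳ (≡⇒≈ (cong (λ e → [ e ] F []) injb))
  Σ-injective-extensions {n = n} {p} b injb f f-inj enumerates (suc r) F = begin
      Σ (allPMaps (suc r) n) (λ t → [ isInj (t Vec.++ b) ] F t)
    ≈⟨ Σ-allPMaps-suc r n _ ⟩
      Σ (allPMaps r n) (λ t → ([ isInj (t Vec.++ b) ] F (nothing ∷ t))
                              + Σ (allFin n) (λ c → [ notIn c (t Vec.++ b) ∧ isInj (t Vec.++ b) ] F (just c ∷ t)))
    ≈⟨ Σ-cong (allPMaps r n) (λ t → pull (isInj (t Vec.++ b)) (F (nothing ∷ t)) (allFin n) (λ c → notIn c (t Vec.++ b)) (λ c → F (just c ∷ t))) ⟩
      Σ (allPMaps r n) (λ t → [ isInj (t Vec.++ b) ] G t)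
    ≈⟨ Σ-injective-extensions b injb f f-inj enumerates r G ⟩
      Σ (allPMaps r p) (λ τ → [ isInj τ ] G (mapCols f τ))
    ≈⟨ Σ-cong (allPMaps r p) (λ τ → [-]-cong (isInj τ) (+-congˡ (new-row τ))) ⟩
      Σ (allPMaps r p) (λ τ → [ isInj τ ] (F (mapCols f (nothing ∷ τ)) + Σ (allFin p) (λ i → [ notIn i τ ] F (mapCols f (just i ∷ τ)))))
    ≈⟨ Σ-cong (allPMaps r p) (λ τ → ≈-sym (pull (isInj τ) _ (allFin p) (λ i → notIn i τ) (λ i → F (mapCols f (just i ∷ τ))))) ⟩
      Σ (allPMaps r p) (λ τ → ([ isInj τ ] F (mapCols f (nothing ∷ τ)))
                              + Σ (allFin p) (λ i → [ notIn i τ ∧ isInj τ ] F (mapCols f (just i ∷ τ))))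
    ≈⟨ Σ-allPMaps-suc r p _ ⟨
      Σ (allPMaps (suc r) p) (λ τ → [ isInj τ ] F (mapCols f τ)) ∎
    where
    G : PMap r n → Carrier
    G t = F (nothing ∷ t) + Σ (allFin n) (λ c → [ notIn c (t Vec.++ b) ] F (just c ∷ t))
    pull : ∀ {A : Set} i X (xs : List A) (a : A → Bool) (Y : A → Carrier) →
           ([ i ] X) + Σ xs (λ c → [ a c ∧ i ] Y c) ≈ [ i ] (X + Σ xs (λ c → [ a c ] Y c))
    pull true  X xs a Y = +-congˡ (≡⇒≈ (Σ-cong-≡ xs (λ c → cong (λ e → [ e ] Y c) (∧-comm (a c) true))))
    pull false X xs a Y = ≈-trans (+-identityˡ _)
      (≈-trans (≡⇒≈ (Σ-cong-≡ xs (λ c → cong (λ e → [ e ] Y c) (∧-comm (a c) false)))) (Σ-0 xs))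
    new-row : ∀ τ → Σ (allFin n) (λ c → [ notIn c (mapCols f τ Vec.++ b) ] F (just c ∷ mapCols f τ))
                  ≈ Σ (allFin p) (λ i → [ notIn i τ ] F (mapCols f (just i ∷ τ)))
    new-row τ = begin
        Σ (allFin n) (λ c → [ notIn c (mapCols f τ Vec.++ b) ] F (just c ∷ mapCols f τ))
      ≡⟨ Σ-cong-≡ (allFin n) (λ c → trans (cong (λ e → [ e ] F (just c ∷ mapCols f τ))
                                             (trans (notIn-++ c (mapCols f τ) b) (∧-comm (notIn c (mapCols f τ)) (notIn c b))))
                                           (sym ([-]-∧ (notIn c b) (notIn c (mapCols f τ)) _))) ⟩
        Σ (allFin n) (λ c → [ notIn c b ] [ notIn c (mapCols f τ) ] F (just c ∷ mapCols f τ))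
      ≈⟨ enumerates (λ c → [ notIn c (mapCols f τ) ] F (just c ∷ mapCols f τ)) ⟩
        Σ (allFin p) (λ i → [ notIn (f i) (mapCols f τ) ] F (just (f i) ∷ mapCols f τ))
      ≡⟨ Σ-cong-≡ (allFin p) (λ i → cong (λ e → [ e ] F (just (f i) ∷ mapCols f τ)) (notIn-mapCols f f-inj i τ)) ⟩
        Σ (allFin p) (λ i → [ notIn i τ ] F (mapCols f (just i ∷ τ))) ∎

  prodA-cong : ∀ {m q} (A B : Fin m → Fin q → Carrier) → (∀ i c → A i c ≡ B i c) → ∀ v → prodA A v ≡ prodA B v
  prodA-cong A B h []            = refl
  prodA-cong A B h (nothing ∷ v) = prodA-cong (A ∘ Fin.suc) (B ∘ Fin.suc) (h ∘ Fin.suc) v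
  prodA-cong A B h (just c ∷ v)  = cong₂ _*_ (h Fin.zero c) (prodA-cong (A ∘ Fin.suc) (B ∘ Fin.suc) (h ∘ Fin.suc) v)

  prodA-++ : ∀ {r s q} (A : Fin (r ℕ.+ s) → Fin q → Carrier) (t : PMap r q) (b : PMap s q) →
             prodA A (t Vec.++ b) ≈ prodA (λ i → A (i ↑ˡ s)) t * prodA (λ i → A (r ↑ʳ i)) b
  prodA-++ A []            b = ≈-sym (*-identityˡ _)
  prodA-++ A (nothing ∷ t) b = prodA-++ (A ∘ Fin.suc) t b
  prodA-++ A (just c ∷ t)  b = ≈-trans (*-congˡ (prodA-++ (A ∘ Fin.suc) t b)) (≈-sym (*-assoc _ _ _))

  prodA-nothings-++ : ∀ r {s q} (A : Fin (r ℕ.+ s) → Fin q → Carrier) (b : PMap s q) →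
                      prodA A (nothings r Vec.++ b) ≡ prodA (λ i → A (r ↑ʳ i)) b
  prodA-nothings-++ zero    A b = refl
  prodA-nothings-++ (suc r) A b = prodA-nothings-++ r (A ∘ Fin.suc) b

  prodA-nothings : ∀ s {q} (A : Fin s → Fin q → Carrier) → prodA A (nothings s) ≡ 1#
  prodA-nothings zero    A = refl
  prodA-nothings (suc s) A = prodA-nothings s (A ∘ Fin.suc)

  prodA-mapCols : ∀ {r p n} (A : Fin r → Fin n → Carrier) (f : Fin p → Fin n) (τ : PMap r p) →
                  prodA A (mapCols f τ) ≡ prodA (λ i c → A i (f c)) τ
  prodA-mapCols A f []            = refl
  prodA-mapCols A f (nothing ∷ τ) = prodA-mapCols (A ∘ Fin.suc) f τ
  prodA-mapCols A f (just c ∷ τ)  = cong (A Fin.zero (f c) *_) (prodA-mapCols (A ∘ Fin.suc) f τ)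

  pow-+ : ∀ a i j → pow a (i ℕ.+ j) ≈ pow a i * pow a j
  pow-+ a zero    j = ≈-sym (*-identityˡ _)
  pow-+ a (suc i) j = ≈-trans (*-congˡ (pow-+ a i j)) (≈-sym (*-assoc _ _ _))

  weight-nothings : ∀ {m q} x z (A : Fin m → Fin q → Carrier) → weight x z A (nothings m) ≈ 1#
  weight-nothings {m} x z A = begin
    weight x z A (nothings m)   ≡⟨ cong₂ _*_ (cong₂ _*_ (cong (pow z) (cycles-nothings m)) (prodA-nothings m A))
                                             (cong (pow x) (domSize-nothings m)) ⟩
    1# * 1# * 1#                ≈⟨ *-identityʳ _ ⟩
    1# * 1#                     ≈⟨ *-identityʳ _ ⟩
    1#                          ∎

  module _ {r s n : ℕ} (m≤n : r ℕ.+ s ≤ n) (r≤m : r ≤ r ℕ.+ s) (b : PMap s n) (injb : isInj b ≡ true) where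
    open BottomPart {r} m≤n b injb

    columns-enumerate : ∀ (H : Fin n → Carrier) → Σ (allFin n) (λ c → [ notIn c b ] H c) ≈ Σ (allFin width) (H ∘ column)
    columns-enumerate H = begin
        Σ (allFin n) (λ c → [ notIn c b ] H c)
      ≈⟨ Σ-cong (allFin n) (λ c → ≈-sym (count-hits c (H c))) ⟩
        Σ (allFin n) (λ c → Σ (allFin n) (λ d → [ isFree d ] [ toℕ (barColumn d) ≡ᵇ toℕ c ] H c))
      ≈⟨ Σ-swap (allFin n) (allFin n) _ ⟩
        Σ (allFin n) (λ d → Σ (allFin n) (λ c → [ isFree d ] [ toℕ (barColumn d) ≡ᵇ toℕ c ] H c))
      ≈⟨ Σ-cong (allFin n) (λ d → Σ-[-] (allFin n) (isFree d) _) ⟩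
        Σ (allFin n) (λ d → [ isFree d ] Σ (allFin n) (λ c → [ toℕ (barColumn d) ≡ᵇ toℕ c ] H c))
      ≈⟨ Σ-cong (allFin n) (λ d → [-]-cong (isFree d) (Σ-allFin-δ n (barColumn d) H)) ⟩
        Σ (allFin n) (λ d → [ isFree d ] H (barColumn d))
      ≈⟨ Σ-filter isFree (allFin n) (H ∘ barColumn) ⟨
        Σ freeColumns (H ∘ barColumn)
      ≡⟨ Σ-map barColumn freeColumns H ⟨
        Σ (phiBar m≤n ψ) H
      ≡⟨ cong (λ l → Σ l H) (Listₚ.tabulate-lookup (phiBar m≤n ψ)) ⟨
        sumL (map H (tabulate column))
      ≡⟨ cong sumL (trans (Listₚ.map-tabulate id (H ∘ column)) (sym (Listₚ.map-tabulate column H))) ⟨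
        Σ (allFin width) (H ∘ column) ∎
      where
      count-hits : ∀ c X → Σ (allFin n) (λ d → [ isFree d ] [ toℕ (barColumn d) ≡ᵇ toℕ c ] X) ≈ [ notIn c b ] X
      count-hits c X with notIn c b in e
      ... | true  = let (d₀ , unique) = hits-unique c e in
                    ≈-trans (≡⇒≈ (Σ-cong-≡ (allFin n) (λ d → trans ([-]-∧ (isFree d) _ X) (cong (λ w → [ w ] X) (unique d)))))
                            (Σ-allFin-δ n d₀ (λ _ → X))
      ... | false = ≈-trans (≡⇒≈ (Σ-cong-≡ (allFin n) (λ d → trans ([-]-∧ (isFree d) _ X) (cong (λ w → [ w ] X) (hits-none c e d)))))
                            (Σ-0 (allFin n))

    weight-++ : ∀ (A : Fin (r ℕ.+ s) → Fin n → Carrier) x z (τ : PMap r width) →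
                weight x z A (mapCols column τ Vec.++ b) ≈ weight x z A ψ * weight x z (subM A r≤m (phiBar m≤n ψ)) τ
    weight-++ A x z τ = begin
        weight x z A v
      ≈⟨ *-cong (*-cong powz prod) powx ⟩
        ((zψ * zτ) * (Pτ * Pb)) * (xτ * xψ)
      ≈⟨ rearrange zψ zτ Pτ Pb xτ xψ ⟩
        ((zψ * Pb) * xψ) * ((zτ * Pτ) * xτ)
      ≡⟨ cong (λ w → ((zψ * w) * xψ) * ((zτ * Pτ) * xτ)) (prodA-nothings-++ r A b) ⟨
        weight x z A ψ * weight x z (subM A r≤m (phiBar m≤n ψ)) τ ∎
      where
      open import Algebra.Solver.CommutativeMonoid *-commutativeMonoid using (prove; var; _⊕_)
      v = mapCols column τ Vec.++ b
      zψ = pow z (cycles ψ)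
      zτ = pow z (cycles τ)
      Pτ = prodA (subM A r≤m (phiBar m≤n ψ)) τ
      Pb = prodA (λ i → A (r ↑ʳ i)) b
      xτ = pow x (domSize τ)
      xψ = pow x (domSize ψ)
      powz : pow z (cycles v) ≈ zψ * zτ
      powz = ≈-trans (≡⇒≈ (cong (pow z) (cycles-++ τ))) (pow-+ z (cycles ψ) (cycles τ))
      prod : prodA A v ≈ Pτ * Pb
      prod = ≈-trans (prodA-++ A (mapCols column τ) b) (*-congʳ (≡⇒≈ (trans (prodA-mapCols (λ i → A (i ↑ˡ s)) column τ)
               (prodA-cong _ _ (λ i c → cong (λ i′ → A i′ (column c)) (toℕ-injective (trans (toℕ-↑ˡ i s) (sym (toℕ-inject≤ i r≤m))))) τ))))
      powx : pow x (domSize v) ≈ xτ * xψ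
      powx = ≈-trans (≡⇒≈ (cong (pow x) (trans (domSize-++ (mapCols column τ) b)
                 (cong₂ ℕ._+_ (domSize-mapCols column τ) (sym (domSize-nothings-++ r b))))))
               (pow-+ x (domSize τ) (domSize ψ))
      rearrange : ∀ a b c d e f → ((a * b) * (c * d)) * (e * f) ≈ ((a * d) * f) * ((b * c) * e)
      rearrange a b c d e f = prove 6 (((x₁ ⊕ x₂) ⊕ (x₃ ⊕ x₄)) ⊕ (x₅ ⊕ x₆)) (((x₁ ⊕ x₄) ⊕ x₆) ⊕ ((x₂ ⊕ x₃) ⊕ x₅))
                                    (a ∷ b ∷ c ∷ d ∷ e ∷ f ∷ [])
        where
        x₁ = var (Fin.zero)
        x₂ = var (Fin.suc Fin.zero)
        x₃ = var (Fin.suc (Fin.suc Fin.zero))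
        x₄ = var (Fin.suc (Fin.suc (Fin.suc Fin.zero)))
        x₅ = var (Fin.suc (Fin.suc (Fin.suc (Fin.suc Fin.zero))))
        x₆ = var (Fin.suc (Fin.suc (Fin.suc (Fin.suc (Fin.suc Fin.zero)))))

    Σ-fibre : ∀ (A : Fin (r ℕ.+ s) → Fin n → Carrier) x z →
              Σ (allPMaps r n) (λ t → [ isInj (t Vec.++ b) ] weight x z A (t Vec.++ b))
              ≈ weight x z A ψ * rookPoly x z (subM A r≤m (phiBar m≤n ψ))
    Σ-fibre A x z = begin
        Σ (allPMaps r n) (λ t → [ isInj (t Vec.++ b) ] weight x z A (t Vec.++ b))
      ≈⟨ Σ-injective-extensions b injb column column-injective columns-enumerate r (λ t → weight x z A (t Vec.++ b)) ⟩
        Σ (allPMaps r width) (λ τ → [ isInj τ ] weight x z A (mapCols column τ Vec.++ b))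
      ≈⟨ Σ-cong (allPMaps r width) (λ τ → [-]-cong (isInj τ) (weight-++ A x z τ)) ⟩
        Σ (allPMaps r width) (λ τ → [ isInj τ ] (Wψ * weight x z B τ))
      ≈⟨ Σ-cong (allPMaps r width) (λ τ → ≈-sym ([-]-*ˡ (isInj τ) Wψ _)) ⟩
        Σ (allPMaps r width) (λ τ → Wψ * ([ isInj τ ] weight x z B τ))
      ≈⟨ Σ-*ˡ (allPMaps r width) Wψ _ ⟨
        Wψ * Σ (allPMaps r width) (λ τ → [ isInj τ ] weight x z B τ)
      ≈⟨ *-congˡ (Σ-filter isInj (allPMaps r width) _) ⟨
        Wψ * Σ (Inj r width) (weight x z B)
      ≈⟨ *-congˡ (rookPoly-as-sum x z B) ⟨
        Wψ * rookPoly x z B ∎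
      where
      Wψ = weight x z A ψ
      B = subM A r≤m (phiBar m≤n ψ)

  module Expansion {r s n : ℕ} (m≤n : r ℕ.+ s ≤ n) (r≤m : r ≤ r ℕ.+ s)
                   (A : Fin (r ℕ.+ s) → Fin n → Carrier) (x z : Carrier) where

    term : PMap (r ℕ.+ s) n → Carrier
    term φ = pow z (cycles φ) * prodA A φ * rookPoly x z (subM A r≤m (phiBar m≤n φ)) * pow x (domSize φ)

    fibre : PMap s n → Carrier
    fibre b = weight x z A (nothings r Vec.++ b) * rookPoly x z (subM A r≤m (phiBar m≤n (nothings r Vec.++ b)))

    rookPoly-by-bottom : rookPoly x z A ≈ Σ (allPMaps s n) (λ b → [ isInj b ] fibre b)
    rookPoly-by-bottom = begin
        rookPoly x z A
      ≈⟨ rookPoly-as-sum x z A ⟩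
        Σ (Inj (r ℕ.+ s) n) (weight x z A)
      ≈⟨ Σ-filter isInj (allPMaps (r ℕ.+ s) n) (weight x z A) ⟩
        Σ (allPMaps (r ℕ.+ s) n) (λ v → [ isInj v ] weight x z A v)
      ≈⟨ Σ-allPMaps-++ r s n _ ⟩
        Σ (allPMaps s n) (λ b → Σ (allPMaps r n) (λ t → [ isInj (t Vec.++ b) ] weight x z A (t Vec.++ b)))
      ≈⟨ Σ-cong (allPMaps s n) by-bottom ⟩
        Σ (allPMaps s n) (λ b → [ isInj b ] fibre b) ∎
      where
      by-bottom : ∀ b → Σ (allPMaps r n) (λ t → [ isInj (t Vec.++ b) ] weight x z A (t Vec.++ b)) ≈ [ isInj b ] fibre b
      by-bottom b with isInj b in injb
      ... | true  = Σ-fibre m≤n r≤m b injb A x z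
      ... | false = ≈-trans (Σ-cong (allPMaps r n) no-extension) (Σ-0 (allPMaps r n))
        where
        no-extension : ∀ t → [ isInj (t Vec.++ b) ] weight x z A (t Vec.++ b) ≈ 0#
        no-extension t with isInj (t Vec.++ b) in inj
        ... | true  = ⊥-elim (true≢false (trans (sym (isInj-++ʳ t b inj)) injb))
        ... | false = ≈-refl

    empty-bottom : Σ (allPMaps s n) (λ b → [ isInj b ∧ (domSize b ≡ᵇ 0) ] fibre b) ≈ rookPoly x z (subM A r≤m (allFin n))
    empty-bottom = begin
        Σ (allPMaps s n) (λ b → [ isInj b ∧ (domSize b ≡ᵇ 0) ] fibre b)
      ≡⟨ Σ-cong-≡ (allPMaps s n) (λ b → trans (cong (λ w → [ w ] fibre b) (∧-comm (isInj b) _))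
                                               (sym ([-]-∧ (domSize b ≡ᵇ 0) (isInj b) (fibre b)))) ⟩
        Σ (allPMaps s n) (λ b → [ domSize b ≡ᵇ 0 ] [ isInj b ] fibre b)
      ≈⟨ Σ-allPMaps-domSize≡0 s n (λ b → [ isInj b ] fibre b) ⟩
        [ isInj (nothings s) ] fibre (nothings s)
      ≡⟨ cong (λ w → [ w ] fibre (nothings s)) (isInj-nothings s) ⟩
        fibre (nothings s)
      ≡⟨ cong (λ ψ → weight x z A ψ * rookPoly x z (subM A r≤m (phiBar m≤n ψ))) (nothings-++ r s) ⟩
        weight x z A (nothings (r ℕ.+ s)) * rookPoly x z (subM A r≤m (phiBar m≤n (nothings (r ℕ.+ s))))
      ≈⟨ *-cong (weight-nothings x z A) (≡⇒≈ (cong (λ L → rookPoly x z (subM A r≤m L)) (phiBar-nothings m≤n))) ⟩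
        1# * rookPoly x z (subM A r≤m (allFin n))
      ≈⟨ *-identityˡ _ ⟩
        rookPoly x z (subM A r≤m (allFin n)) ∎

    -- φ has support in the bottom rows iff its top part is empty and its bottom part is not
    nonempty-bottom : Σ (filterᵇ (supportAbove r) (Inj (r ℕ.+ s) n)) term
                      ≈ Σ (allPMaps s n) (λ b → [ isInj b ∧ not (domSize b ≡ᵇ 0) ] fibre b)
    nonempty-bottom = begin
        Σ (filterᵇ (supportAbove r) (Inj (r ℕ.+ s) n)) term
      ≈⟨ Σ-filter (supportAbove r) (Inj (r ℕ.+ s) n) term ⟩
        Σ (Inj (r ℕ.+ s) n) (λ v → [ supportAbove r v ] term v)
      ≈⟨ Σ-filter isInj (allPMaps (r ℕ.+ s) n) _ ⟩
        Σ (allPMaps (r ℕ.+ s) n) (λ v → [ isInj v ] [ supportAbove r v ] term v)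
      ≈⟨ Σ-allPMaps-++ r s n _ ⟩
        Σ (allPMaps s n) (λ b → Σ (allPMaps r n) (λ t → summand b t))
      ≈⟨ Σ-cong (allPMaps s n) top-empty ⟩
        Σ (allPMaps s n) (λ b → [ isInj b ∧ not (domSize b ≡ᵇ 0) ] fibre b) ∎
      where
      summand : PMap s n → PMap r n → Carrier
      summand b t = [ isInj (t Vec.++ b) ] [ supportAbove r (t Vec.++ b) ] term (t Vec.++ b)
      only-empty-top : ∀ b t → summand b t ≈ [ domSize t ≡ᵇ 0 ] summand b t
      only-empty-top b t with domSize t ≡ᵇ 0 in e
      ... | true  = ≈-refl
      ... | false rewrite supportAbove-++ t b e = [-]-0 (isInj (t Vec.++ b))
      top-empty : ∀ b → Σ (allPMaps r n) (summand b) ≈ [ isInj b ∧ not (domSize b ≡ᵇ 0) ] fibre b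
      top-empty b = begin
          Σ (allPMaps r n) (summand b)
        ≈⟨ Σ-cong (allPMaps r n) (only-empty-top b) ⟩
          Σ (allPMaps r n) (λ t → [ domSize t ≡ᵇ 0 ] summand b t)
        ≈⟨ Σ-allPMaps-domSize≡0 r n (summand b) ⟩
          summand b (nothings r)
        ≡⟨ cong₂ (λ i j → [ i ] [ j ] term (nothings r Vec.++ b)) (isInj-nothings-++ r b) (supportAbove-nothings-++ {r} b) ⟩
          [ isInj b ] [ not (domSize b ≡ᵇ 0) ] term (nothings r Vec.++ b)
        ≡⟨ [-]-∧ (isInj b) _ _ ⟩
          [ isInj b ∧ not (domSize b ≡ᵇ 0) ] term (nothings r Vec.++ b)
        ≈⟨ [-]-cong (isInj b ∧ not (domSize b ≡ᵇ 0)) (*-comm-last _ _ _ _) ⟩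
          [ isInj b ∧ not (domSize b ≡ᵇ 0) ] fibre b ∎
        where
        *-comm-last : ∀ a b c d → a * b * c * d ≈ (a * b * d) * c
        *-comm-last a b c d = ≈-trans (*-assoc _ _ _) (≈-trans (*-congˡ (*-comm c d)) (≈-sym (*-assoc _ _ _)))

    rookPoly-expansion-+ : rookPoly x z A ≈ Σ (filterᵇ (supportAbove r) (Inj (r ℕ.+ s) n)) term
                                             + rookPoly x z (subM A r≤m (allFin n))
    rookPoly-expansion-+ = begin
        rookPoly x z A
      ≈⟨ rookPoly-by-bottom ⟩
        Σ (allPMaps s n) (λ b → [ isInj b ] fibre b)
      ≈⟨ Σ-cong (allPMaps s n) (λ b → [-]-split (isInj b) (domSize b ≡ᵇ 0) (fibre b)) ⟩
        Σ (allPMaps s n) (λ b → ([ isInj b ∧ not (domSize b ≡ᵇ 0) ] fibre b) + ([ isInj b ∧ (domSize b ≡ᵇ 0) ] fibre b))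
      ≈⟨ Σ-+ (allPMaps s n) _ _ ⟩
        Σ (allPMaps s n) (λ b → [ isInj b ∧ not (domSize b ≡ᵇ 0) ] fibre b)
          + Σ (allPMaps s n) (λ b → [ isInj b ∧ (domSize b ≡ᵇ 0) ] fibre b)
      ≈⟨ +-cong (≈-sym nonempty-bottom) empty-bottom ⟩
        Σ (filterᵇ (supportAbove r) (Inj (r ℕ.+ s) n)) term + rookPoly x z (subM A r≤m (allFin n)) ∎

  rookPoly-expansion : ∀ {r m n} (m≤n : m ≤ n) (r≤m : r ≤ m) (A : Fin m → Fin n → Carrier) x z →
    rookPoly x z A ≈
    sumL (map (λ φ → pow z (cycles φ) * prodA A φ * rookPoly x z (subM A r≤m (phiBar m≤n φ)) * pow x (domSize φ))
              (filterᵇ (supportAbove r) (Inj m n)))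
    + rookPoly x z (subM A r≤m (allFin n))
  rookPoly-expansion {r} {m} m≤n r≤m = split (m ∸ r) (ℕₚ.m+[n∸m]≡n r≤m) m≤n r≤m
    where
    split : ∀ {m n} s → r ℕ.+ s ≡ m → (m≤n : m ≤ n) (r≤m : r ≤ m) (A : Fin m → Fin n → Carrier) → ∀ x z →
      rookPoly x z A ≈
      sumL (map (λ φ → pow z (cycles φ) * prodA A φ * rookPoly x z (subM A r≤m (phiBar m≤n φ)) * pow x (domSize φ))
                (filterᵇ (supportAbove r) (Inj m n)))
      + rookPoly x z (subM A r≤m (allFin n))
    split s refl m≤n r≤m A x z = Expansion.rookPoly-expansion-+ m≤n r≤m A x z

theorem2 : ∀ {c ℓ} (R : CommutativeRing c ℓ) (m n k : ℕ) (m≤n : m ≤ n) →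
    1 ≤ k → k ≤ m ∸ 1 →
    (A : Fin m → Fin n → CommutativeRing.Carrier R) (x z : CommutativeRing.Carrier R) →
    let open CommutativeRing R
        open Rook R
    in rookPoly x z A ≈
       sumL (map (λ φ → pow z (cycles φ) * prodA A φ
                          * rookPoly x z (subM A (m∸n≤m m k) (phiBar m≤n φ))
                          * pow x (domSize φ))
                 (filterᵇ (supportAbove (m ∸ k)) (Inj m n)))
       + rookPoly x z (subM A (m∸n≤m m k) (allFin n))
theorem2 R m n k m≤n _ _ = rookPoly-expansion R m≤n (m∸n≤m m k)
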